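{- Let $n\ge 11$ and $1\le d\le n-1$ be integers, $T_{n,d}=\frac{n(n+1)}{2}-d$, and $\pi_{n,d}=(1,2,\dots,d-1,d+1,\dots,n)$. For a partition $\lambda$ of $T_{n,d}$ into distinct parts, let $h$ be the number of parts of $\pi_{n,d}$ that are not parts of $\lambda$ and $j$ the number of parts of $\lambda$ that are not parts of $\pi_{n,d}$. Consider $\lambda=(\lambda_1,\dots,\lambda_t)\in\mathbb U^*_{T_{n,d}}$ with $\lambda_t=2n-4$ and $d$ a part of $\lambda$. (i) If $h=j$, then $d=3$, and there is exactly one such partition. (ii) For each integer $k$ with $1\le k\le\lfloor (n-2)/2\rfloor$ there exists such a $\lambda\in\mathbb U^*_{T_{n,d}}$ with $h=j+1$ and $d=n-(2k-1)$, and there is no such $\lambda\in\mathbb U^*_{T_{n,d}}$ with $h=j+1$ and $d=n-2k$.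
   Context: A partition of $N$ into distinct parts is a sequence of positive integers $\lambda_1<\dots<\lambda_t$ summing to $N$ with $t\ge 2$. Its missing parts are the elements of $\{1,\dots,\lambda_t\}\setminus\{\lambda_1,\dots,\lambda_t\}$. $\lambda$ is refinable if two distinct missing parts sum to a part of $\lambda$, unrefinable otherwise; $\mathbb U_N$ is the set of unrefinable partitions of $N$. $\mathbb U^*_N$ is the set of $\lambda\in\mathbb U_N$ whose largest part is the maximum of the largest parts over all of $\mathbb U_N$. Standing assumption: $n\ge 11$. -}

module Defs where

open import Data.Nat using (ℕ; suc; _+_; _*_; _∸_; _≤_; _<_; _⊔_; _/_; _≟_)
open import Data.Nat.ListAction using (sum)
open import Data.List using (List; length; filter; map; upTo; foldr)
open import Data.List.Membership.Propositional using (_∈_; _∉_)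
open import Data.List.Membership.DecPropositional _≟_ using (_∈?_)
open import Data.List.Relation.Unary.All using (All)
open import Data.List.Relation.Unary.AllPairs using (AllPairs)
open import Data.Product using (_×_; ∃-syntax)
open import Relation.Nullary using (¬_; ¬?)
open import Relation.Binary.PropositionalEquality using (_≡_; _≢_)

record DistinctPartition (N : ℕ) (λs : List ℕ) : Set where
  field
    increasing : AllPairs _<_ λs
    positive   : All (0 <_) λs
    sums       : sum λs ≡ N
    twoParts   : 2 ≤ length λs

largest : List ℕ → ℕ
largest = foldr _⊔_ 0

Missing : List ℕ → ℕ → Set
Missing λs m = 1 ≤ m × m ≤ largest λs × m ∉ λs

Refinable : List ℕ → Set
Refinable λs = ∃[ a ] ∃[ b ] (a ≢ b × Missing λs a × Missing λs b × (a + b) ∈ λs)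

Unrefinable : List ℕ → Set
Unrefinable λs = ¬ Refinable λs

InU : ℕ → List ℕ → Set
InU N λs = DistinctPartition N λs × Unrefinable λs

InUStar : ℕ → List ℕ → Set
InUStar N λs = InU N λs × (∀ μ → InU N μ → largest μ ≤ largest λs)

T : ℕ → ℕ → ℕ
T n d = (n * suc n) / 2 ∸ d

π : ℕ → ℕ → List ℕ
π n d = filter (λ x → ¬? (x ≟ d)) (map suc (upTo n))

h : ℕ → ℕ → List ℕ → ℕ
h n d λs = length (filter (λ x → ¬? (x ∈? λs)) (π n d))

j : ℕ → ℕ → List ℕ → ℕ
j n d λs = length (filter (λ x → ¬? (x ∈? π n d)) λs)

Setting : ℕ → ℕ → List ℕ → Set
Setting n d λs = InUStar (T n d) λs × largest λs ≡ 2 * n ∸ 4 × d ∈ λs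

{-# OPTIONS --safe #-}
-- Write n = q + 3, so that the largest part is λₜ = 2q + 2. Unrefinability forces every pair
-- {a, λₜ − a} with 1 ≤ a ≤ q to contain a part. Comparing the sum of λ with T n d, and its
-- length with that of π n d, gives
--   Σ excess + [q + 1 ∈ λ]·(q + 1) + d = q + 4   and   h + Σ doubled + [q + 1 ∈ λ] = j + 1,
-- where a pair has excess 0 if only a is a part, 2(q + 1 − a) if only λₜ − a is, and at least
-- q + 2 if both are (it is then doubled). Maximality of λₜ rules out d ≤ 2, because 1, …, q + 1
-- together with one part above λₜ is unrefinable. If h = j, a doubled pair would push the left
-- side past q + 4, so q + 1 ∈ λ, d = 3 and every excess vanishes: λ = (1, …, q + 1, 2q + 2).
-- If h = j + 1, no pair is doubled and q + 1 ∉ λ, so all excesses are even and so is q + 4 − d;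
-- conversely, replacing one or two small parts p by λₜ − p realises every even total 2k.
module Submission where

open import Defs
open import Data.Nat
open import Data.Nat.Properties
open import Data.Empty using (⊥-elim)
open import Data.List using (List; []; _∷_; length; filter; map; upTo)
open import Data.List.Membership.DecPropositional _≟_ using (_∈?_)
open import Data.List.Membership.Propositional using (_∈_; _∉_)
open import Data.List.Membership.Propositional.Properties using (∈-map⁺; ∈-map⁻; ∈-upTo⁺; ∈-upTo⁻; ∈-filter⁺; ∈-filter⁻)
open import Data.List.Properties using (map-id)
open import Data.List.Relation.Unary.All as All using (All)
open import Data.List.Relation.Unary.AllPairs as AllPairs using (AllPairs)
import Data.List.Relation.Unary.AllPairs.Properties as AllPairsₚ
open import Data.List.Relation.Unary.Any using (here; there)
open import Data.Nat.DivMod using (m*n/n≡m; m/n*n≤m)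
open import Data.Nat.Divisibility using (_∣_; _∣0; ∣m∣n⇒∣m+n; ∣m+n∣m⇒∣n; ∣1⇒≡1; m∣m*n)
open import Data.Nat.ListAction using (sum)
open import Data.Nat.Tactic.RingSolver using (solve; solve-∀)
open import Data.Product using (Σ-syntax; ∃-syntax; _×_; _,_; proj₁; proj₂)
open import Data.Sum using (_⊎_; inj₁; inj₂)
open import Relation.Binary.Definitions using (tri<; tri≈; tri>)
open import Relation.Binary.PropositionalEquality
open import Relation.Nullary using (Dec; yes; no; ¬_; ¬?; contradiction)
open import Relation.Nullary.Decidable using (_⊎-dec_; _×-dec_)
open import Relation.Unary using (Decidable)
open import Algebra.Properties.CommutativeSemigroup +-commutativeSemigroup
  using () renaming (interchange to +-interchange)
open DistinctPartition

-- Finite sums over 1‥k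

infix 0 if?_then_
if?_then_ : ∀ {a} {A : Set a} → Dec A → ℕ → ℕ
if? yes _ then v = v
if? no _  then v = 0

if?-yes : ∀ {a} {A : Set a} (D : Dec A) {v} → A → (if? D then v) ≡ v
if?-yes (yes _) _ = refl
if?-yes (no ¬a) a = ⊥-elim (¬a a)

if?-no : ∀ {a} {A : Set a} (D : Dec A) {v} → ¬ A → (if? D then v) ≡ 0
if?-no (yes a) ¬a = ⊥-elim (¬a a)
if?-no (no _)  _  = refl

∑ : (ℕ → ℕ) → ℕ → ℕ
∑ f zero    = 0
∑ f (suc k) = ∑ f k + f (suc k)

tri : ℕ → ℕ
tri = ∑ (λ x → x)

In[1,_] : ℕ → ℕ → Set
In[1, k ] x = 1 ≤ x × x ≤ k

private
  init-In : ∀ {k} {P : ℕ → Set} → (∀ x → In[1, suc k ] x → P x) → ∀ x → In[1, k ] x → P x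
  init-In h x (1≤x , x≤k) = h x (1≤x , m≤n⇒m≤1+n x≤k)

  last-In : ∀ {k} {P : ℕ → Set} → (∀ x → In[1, suc k ] x → P x) → P (suc k)
  last-In h = h _ (s≤s z≤n , ≤-refl)

∑-cong : ∀ {f g} k → (∀ x → In[1, k ] x → f x ≡ g x) → ∑ f k ≡ ∑ g k
∑-cong zero    h = refl
∑-cong (suc k) h = cong₂ _+_ (∑-cong k (init-In h)) (last-In h)

∑-mono-≤ : ∀ {f g} k → (∀ x → In[1, k ] x → f x ≤ g x) → ∑ f k ≤ ∑ g k
∑-mono-≤ zero    h = z≤n
∑-mono-≤ (suc k) h = +-mono-≤ (∑-mono-≤ k (init-In h)) (last-In h)

∑-zero : ∀ (f : ℕ → ℕ) k → (∀ x → In[1, k ] x → f x ≡ 0) → ∑ f k ≡ 0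
∑-zero f k h = trans (∑-cong k h) (∑-const0 k)
  where
  ∑-const0 : ∀ k → ∑ (λ _ → 0) k ≡ 0
  ∑-const0 zero    = refl
  ∑-const0 (suc k) = cong (_+ 0) (∑-const0 k)

∑-const1 : ∀ k → ∑ (λ _ → 1) k ≡ k
∑-const1 zero    = refl
∑-const1 (suc k) = trans (+-comm (∑ (λ _ → 1) k) 1) (cong suc (∑-const1 k))

∑-+ : ∀ (f g : ℕ → ℕ) k → ∑ (λ x → f x + g x) k ≡ ∑ f k + ∑ g k
∑-+ f g zero    = refl
∑-+ f g (suc k) rewrite ∑-+ f g k = +-interchange (∑ f k) (∑ g k) (f (suc k)) (g (suc k))

f≤∑ : ∀ (f : ℕ → ℕ) k x → In[1, k ] x → f x ≤ ∑ f k
f≤∑ f zero    (suc _) (_ , ())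
f≤∑ f (suc k) x (1≤x , x≤1+k) with m≤n⇒m<n∨m≡n x≤1+k
... | inj₁ (s≤s x≤k) = ≤-trans (f≤∑ f k x (1≤x , x≤k)) (m≤m+n _ _)
... | inj₂ refl      = m≤n+m _ _

∑≡0⇒f≡0 : ∀ (f : ℕ → ℕ) k → ∑ f k ≡ 0 → ∀ x → In[1, k ] x → f x ≡ 0
∑≡0⇒f≡0 f k ∑≡0 x x∈ = n≤0⇒n≡0 (≤-trans (f≤∑ f k x x∈) (≤-reflexive ∑≡0))

∑>0⇒∃f>0 : ∀ (f : ℕ → ℕ) k → 0 < ∑ f k → ∃[ x ] (In[1, k ] x × 0 < f x)
∑>0⇒∃f>0 f (suc k) ∑>0 with f (suc k) in eq
... | suc _ = suc k , (s≤s z≤n , ≤-refl) , subst (0 <_) (sym eq) (s≤s z≤n)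
... | zero with ∑>0⇒∃f>0 f k (subst (0 <_) (+-identityʳ _) ∑>0)
...   | x , (1≤x , x≤k) , fx>0 = x , (1≤x , m≤n⇒m≤1+n x≤k) , fx>0

2∣∑ : ∀ (f : ℕ → ℕ) k → (∀ x → In[1, k ] x → 2 ∣ f x) → 2 ∣ ∑ f k
2∣∑ f zero    h = 2 ∣0
2∣∑ f (suc k) h = ∣m∣n⇒∣m+n (2∣∑ f k (init-In h)) (last-In h)

∑-indicator : ∀ (f : ℕ → ℕ) k c → In[1, k ] c → ∑ (λ x → if? x ≟ c then f x) k ≡ f c
∑-indicator f zero    (suc _) (_ , ())
∑-indicator f (suc k) c (1≤c , c≤1+k) with m≤n⇒m<n∨m≡n c≤1+k
... | inj₁ (s≤s c≤k) =
  trans (cong₂ _+_ (∑-indicator f k c (1≤c , c≤k)) (if?-no (suc k ≟ c) {f (suc k)} (>⇒≢ (s≤s c≤k))))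
        (+-identityʳ _)
... | inj₂ refl =
  cong₂ _+_ (∑-zero (λ x → if? x ≟ suc k then f x) k (λ x (_ , x≤k) → if?-no (x ≟ suc k) {f x} (<⇒≢ (s≤s x≤k))))
            (if?-yes (suc k ≟ suc k) {f (suc k)} refl)

∑-split : ∀ (f : ℕ → ℕ) a b → ∑ f (a + b) ≡ ∑ f a + ∑ (λ i → f (a + i)) b
∑-split f a zero    rewrite +-identityʳ a = sym (+-identityʳ _)
∑-split f a (suc b) rewrite +-suc a b | ∑-split f a b = +-assoc (∑ f a) _ _

∑-unconsˡ : ∀ (f : ℕ → ℕ) k → ∑ f (suc k) ≡ f 1 + ∑ (λ i → f (suc i)) k
∑-unconsˡ f zero    = +-comm 0 (f 1)
∑-unconsˡ f (suc k) rewrite ∑-unconsˡ f k = +-assoc (f 1) _ _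

∑-reverse : ∀ (f : ℕ → ℕ) k → ∑ (λ i → f (suc k ∸ i)) k ≡ ∑ f k
∑-reverse f zero    = refl
∑-reverse f (suc k) = begin
    ∑ (λ i → f (2 + k ∸ i)) k + f (suc k ∸ k)   ≡⟨ cong₂ _+_ (∑-cong k shift) (cong f (m+n∸n≡m 1 k)) ⟩
    ∑ (λ i → f (suc (suc k ∸ i))) k + f 1     ≡⟨ cong (_+ f 1) (∑-reverse (λ i → f (suc i)) k) ⟩
    ∑ (λ i → f (suc i)) k + f 1               ≡⟨ +-comm _ (f 1) ⟩
    f 1 + ∑ (λ i → f (suc i)) k               ≡⟨ ∑-unconsˡ f k ⟨
    ∑ f (suc k)                               ∎
  where
  open ≡-Reasoning
  shift : ∀ i → In[1, k ] i → f (2 + k ∸ i) ≡ f (suc (suc k ∸ i))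
  shift i (_ , i≤k) = cong f (+-∸-assoc 1 (m≤n⇒m≤1+n i≤k))

∑-foldEnds : ∀ (f : ℕ → ℕ) q r → let L = q + (r + suc q) in
             ∑ f L ≡ ∑ f q + ∑ (λ i → f (q + i)) r + ∑ (λ a → f (L ∸ a)) q + f L
∑-foldEnds f q r = begin
    ∑ f L                                                     ≡⟨ ∑-split f q (r + suc q) ⟩
    ∑ f q + ∑ g (r + suc q)                                   ≡⟨ cong (∑ f q +_) (∑-split g r (suc q)) ⟩
    ∑ f q + (∑ g r + (∑ (λ i → g (r + i)) q + f L))           ≡⟨ cong (λ z → ∑ f q + (∑ g r + (z + f L))) backwards ⟩
    ∑ f q + (∑ g r + (∑ (λ a → f (L ∸ a)) q + f L))           ≡⟨ reassoc (∑ f q) (∑ g r) _ (f L) ⟩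
    ∑ f q + ∑ g r + ∑ (λ a → f (L ∸ a)) q + f L               ∎
  where
  open ≡-Reasoning
  L = q + (r + suc q)
  g : ℕ → ℕ
  g i = f (q + i)
  L∸a : ∀ a → a ≤ q → q + (r + (suc q ∸ a)) ≡ L ∸ a
  L∸a a a≤q = sym (trans (+-∸-assoc q (≤-trans (m≤n⇒m≤1+n a≤q) (m≤n+m (suc q) r)))
                         (cong (q +_) (+-∸-assoc r (m≤n⇒m≤1+n a≤q))))
  reassoc : ∀ a b c d → a + (b + (c + d)) ≡ a + b + c + d
  reassoc a b c d = trans (sym (+-assoc a b (c + d))) (sym (+-assoc (a + b) c d))
  backwards : ∑ (λ i → g (r + i)) q ≡ ∑ (λ a → f (L ∸ a)) q
  backwards = trans (sym (∑-reverse (λ i → g (r + i)) q))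
                    (∑-cong q (λ a (_ , a≤q) → cong f (L∸a a a≤q)))

∑-pairs≤∑ : ∀ (f : ℕ → ℕ) q L → q + q < L → ∑ (λ a → f a + f (L ∸ a)) q + f L ≤ ∑ f L
∑-pairs≤∑ f q L 2q<L with r , eq ← m≤n⇒∃[o]m+o≡n 2q<L =
  subst (λ L → ∑ (λ a → f a + f (L ∸ a)) q + f L ≤ ∑ f L) (trans split eq) (withMiddle r)
  where
  split : q + (r + suc q) ≡ suc (q + q) + r
  split = solve (q ∷ r ∷ [])
  open ≤-Reasoning
  withMiddle : ∀ r → let L = q + (r + suc q) in ∑ (λ a → f a + f (L ∸ a)) q + f L ≤ ∑ f L
  withMiddle r = let L = q + (r + suc q) in begin
      ∑ (λ a → f a + f (L ∸ a)) q + f L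
    ≡⟨ cong (_+ f L) (∑-+ f _ q) ⟩
      ∑ f q + ∑ (λ a → f (L ∸ a)) q + f L
    ≤⟨ +-monoˡ-≤ (f L) (+-monoˡ-≤ (∑ (λ a → f (L ∸ a)) q) (m≤m+n (∑ f q) _)) ⟩
      ∑ f q + ∑ (λ i → f (q + i)) r + ∑ (λ a → f (L ∸ a)) q + f L
    ≡⟨ ∑-foldEnds f q r ⟨
      ∑ f L
    ∎

-- Strictly increasing lists of positive integers

Increasing : List ℕ → Set
Increasing = AllPairs _<_

oneTo : ℕ → List ℕ
oneTo k = map suc (upTo k)

∈-oneTo⁺ : ∀ {k x} → In[1, k ] x → x ∈ oneTo k
∈-oneTo⁺ {x = suc x} (_ , x<k) = ∈-map⁺ suc (∈-upTo⁺ x<k)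

∈-oneTo⁻ : ∀ {k x} → x ∈ oneTo k → In[1, k ] x
∈-oneTo⁻ x∈ with ∈-map⁻ suc x∈
... | y , y∈ , refl = s≤s z≤n , ∈-upTo⁻ y∈

oneTo-increasing : ∀ k → Increasing (oneTo k)
oneTo-increasing k = AllPairsₚ.map⁺ (AllPairsₚ.applyUpTo⁺₁ (λ i → i) k (λ i<j _ → s≤s i<j))

_∖_ : List ℕ → List ℕ → List ℕ
xs ∖ ys = filter (λ x → ¬? (x ∈? ys)) xs

module _ {B : ℕ} where

  private
    ∉-head : ∀ {y ys} → All (y <_) ys → y ∉ ys
    ∉-head y<ys y∈ys = <-irrefl refl (All.lookup y<ys y∈ys)

    if∈-∷ : ∀ (f : ℕ → ℕ) {y ys} → y ∉ ys → ∀ x →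
            (if? x ∈? (y ∷ ys) then f x) ≡ (if? x ≟ y then f x) + (if? x ∈? ys then f x)
    if∈-∷ f {y} {ys} y∉ys x with x ∈? (y ∷ ys) | x ≟ y | x ∈? ys
    ... | _ | yes refl | yes x∈ys = ⊥-elim (y∉ys x∈ys)
    ... | yes _ | yes _ | no _ = sym (+-identityʳ _)
    ... | yes _ | no _ | yes _ = refl
    ... | yes (here x≡y) | no x≢y | no _ = ⊥-elim (x≢y x≡y)
    ... | yes (there x∈ys) | no _ | no x∉ys = ⊥-elim (x∉ys x∈ys)
    ... | no x∉ | yes x≡y | _ = ⊥-elim (x∉ (here x≡y))
    ... | no x∉ | no _ | yes x∈ys = ⊥-elim (x∉ (there x∈ys))
    ... | no _ | no _ | no _ = refl

  sum-map≡∑ : ∀ (f : ℕ → ℕ) ys → Increasing ys → All In[1, B ] ys →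
              sum (map f ys) ≡ ∑ (λ x → if? x ∈? ys then f x) B
  sum-map≡∑ f [] _ _ = sym (∑-zero _ B (λ _ _ → refl))
  sum-map≡∑ f (y ∷ ys) (y<ys AllPairs.∷ ys↑) (y∈ All.∷ ys∈) = begin
      f y + sum (map f ys)
    ≡⟨ cong₂ _+_ (∑-indicator f B y y∈) (sym (sum-map≡∑ f ys ys↑ ys∈)) ⟨
      ∑ (λ x → if? x ≟ y then f x) B + ∑ (λ x → if? x ∈? ys then f x) B
    ≡⟨ ∑-+ _ _ B ⟨
      ∑ (λ x → (if? x ≟ y then f x) + (if? x ∈? ys then f x)) B
    ≡⟨ ∑-cong B (λ x _ → if∈-∷ f (∉-head y<ys) x) ⟨
      ∑ (λ x → if? x ∈? (y ∷ ys) then f x) B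
    ∎
    where open ≡-Reasoning

  sum≡∑ : ∀ ys → Increasing ys → All In[1, B ] ys → sum ys ≡ ∑ (λ x → if? x ∈? ys then x) B
  sum≡∑ ys ys↑ ys∈ = trans (cong sum (sym (map-id ys))) (sum-map≡∑ (λ x → x) ys ys↑ ys∈)

  length-filter≡∑ : ∀ {P : ℕ → Set} (P? : Decidable P) ys → Increasing ys → All In[1, B ] ys →
                    length (filter P? ys) ≡ ∑ (λ x → if? x ∈? ys then (if? P? x then 1)) B
  length-filter≡∑ P? ys ys↑ ys∈ = trans (length-filter ys) (sum-map≡∑ (λ x → if? P? x then 1) ys ys↑ ys∈)
    where
    length-filter : ∀ ys → length (filter P? ys) ≡ sum (map (λ x → if? P? x then 1) ys)
    length-filter [] = refl
    length-filter (y ∷ ys) with P? y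
    ... | yes _ = cong suc (length-filter ys)
    ... | no _  = length-filter ys

  length≡∑ : ∀ ys → Increasing ys → All In[1, B ] ys → length ys ≡ ∑ (λ x → if? x ∈? ys then 1) B
  length≡∑ ys ys↑ ys∈ = trans (length≡sum-map-1 ys) (sum-map≡∑ (λ _ → 1) ys ys↑ ys∈)
    where
    length≡sum-map-1 : ∀ ys → length ys ≡ sum (map (λ _ → 1) ys)
    length≡sum-map-1 []       = refl
    length≡sum-map-1 (_ ∷ ys) = cong suc (length≡sum-map-1 ys)

  ∣xs∖ys∣+∣ys∣≡∣ys∖xs∣+∣xs∣ : ∀ xs ys → Increasing xs → Increasing ys → All In[1, B ] xs → All In[1, B ] ys →
                            length (xs ∖ ys) + length ys ≡ length (ys ∖ xs) + length xs
  ∣xs∖ys∣+∣ys∣≡∣ys∖xs∣+∣xs∣ xs ys xs↑ ys↑ xs∈ ys∈ = begin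
      length (xs ∖ ys) + length ys
    ≡⟨ cong₂ _+_ (length-filter≡∑ _ xs xs↑ xs∈) (length≡∑ ys ys↑ ys∈) ⟩
      ∑ (λ x → if? x ∈? xs then (if? ¬? (x ∈? ys) then 1)) B + ∑ (λ x → if? x ∈? ys then 1) B
    ≡⟨ ∑-+ _ _ B ⟨
      ∑ (λ x → (if? x ∈? xs then (if? ¬? (x ∈? ys) then 1)) + (if? x ∈? ys then 1)) B
    ≡⟨ ∑-cong B (λ x _ → symmetric x) ⟩
      ∑ (λ x → (if? x ∈? ys then (if? ¬? (x ∈? xs) then 1)) + (if? x ∈? xs then 1)) B
    ≡⟨ ∑-+ _ _ B ⟩
      ∑ (λ x → if? x ∈? ys then (if? ¬? (x ∈? xs) then 1)) B + ∑ (λ x → if? x ∈? xs then 1) B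
    ≡⟨ cong₂ _+_ (length-filter≡∑ _ ys ys↑ ys∈) (length≡∑ xs xs↑ xs∈) ⟨
      length (ys ∖ xs) + length xs
    ∎
    where
    open ≡-Reasoning
    symmetric : ∀ x → (if? x ∈? xs then (if? ¬? (x ∈? ys) then 1)) + (if? x ∈? ys then 1)
                    ≡ (if? x ∈? ys then (if? ¬? (x ∈? xs) then 1)) + (if? x ∈? xs then 1)
    symmetric x with x ∈? xs | x ∈? ys
    ... | yes _ | yes _ = refl
    ... | yes _ | no _  = refl
    ... | no _  | yes _ = refl
    ... | no _  | no _  = refl

∈⇒≤largest : ∀ {x xs} → x ∈ xs → x ≤ largest xs
∈⇒≤largest {x} {y ∷ ys} (here refl) = m≤m⊔n x (largest ys)
∈⇒≤largest {x} {y ∷ ys} (there i)   = ≤-trans (∈⇒≤largest i) (m≤n⊔m y (largest ys))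

largest≤ : ∀ {B xs} → All (_≤ B) xs → largest xs ≤ B
largest≤ All.[]         = z≤n
largest≤ (p All.∷ ps)   = ⊔-lub p (largest≤ ps)

largest∈ : ∀ {xs} → 1 ≤ length xs → largest xs ∈ xs
largest∈ {x ∷ xs} _ = largest-∷∈ x xs
  where
  largest-∷∈ : ∀ x xs → largest (x ∷ xs) ∈ x ∷ xs
  largest-∷∈ x [] rewrite ⊔-identityʳ x = here refl
  largest-∷∈ x (y ∷ ys) with ⊔-sel x (largest (y ∷ ys))
  ... | inj₁ eq = here eq
  ... | inj₂ eq = subst (_∈ x ∷ y ∷ ys) (sym eq) (there (largest-∷∈ y ys))

2≤length : ∀ {x y : ℕ} xs → x ∈ xs → y ∈ xs → x ≢ y → 2 ≤ length xs
2≤length (_ ∷ []) (here refl) (here refl) x≢y = ⊥-elim (x≢y refl)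
2≤length (_ ∷ _ ∷ _) _ _ _ = s≤s (s≤s z≤n)

private
  ∷-≡-head : ∀ {x xs y ys} → All (x <_) xs → All (y <_) ys → x ∈ y ∷ ys → y ∈ x ∷ xs → x ≡ y
  ∷-≡-head _    _    (here eq)  _          = eq
  ∷-≡-head _    _    (there _)  (here eq)  = sym eq
  ∷-≡-head x<xs y<ys (there x∈) (there y∈) = ⊥-elim (<-asym (All.lookup y<ys x∈) (All.lookup x<xs y∈))

  ⊆-tail : ∀ {u us vs} → All (u <_) us → (∀ {z} → z ∈ u ∷ us → z ∈ u ∷ vs) → ∀ {z} → z ∈ us → z ∈ vs
  ⊆-tail u<us us⊆ z∈ with us⊆ (there z∈)
  ... | here refl  = ⊥-elim (<-irrefl refl (All.lookup u<us z∈))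
  ... | there z∈vs = z∈vs

Increasing-≡ : ∀ {xs ys} → Increasing xs → Increasing ys →
               (∀ {x} → x ∈ xs → x ∈ ys) → (∀ {x} → x ∈ ys → x ∈ xs) → xs ≡ ys
Increasing-≡ {[]} {[]} _ _ _ _ = refl
Increasing-≡ {[]} {_ ∷ _} _ _ _ ys⊆ with () ← ys⊆ (here refl)
Increasing-≡ {_ ∷ _} {[]} _ _ xs⊆ _ with () ← xs⊆ (here refl)
Increasing-≡ {x ∷ xs} {y ∷ ys} (x<xs AllPairs.∷ xs↑) (y<ys AllPairs.∷ ys↑) xs⊆ ys⊆
  with refl ← ∷-≡-head x<xs y<ys (xs⊆ (here refl)) (ys⊆ (here refl))
  = cong (x ∷_) (Increasing-≡ xs↑ ys↑ (⊆-tail x<xs xs⊆) (⊆-tail y<ys ys⊆))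

module _ {P : ℕ → Set} (P? : Decidable P) (L : ℕ) where

  sieve : List ℕ
  sieve = filter P? (oneTo L)

  sieve-increasing : Increasing sieve
  sieve-increasing = AllPairsₚ.filter⁺ P? (oneTo-increasing L)

  ∈-sieve⁺ : ∀ {x} → In[1, L ] x → P x → x ∈ sieve
  ∈-sieve⁺ x∈ px = ∈-filter⁺ P? (∈-oneTo⁺ x∈) px

  ∈-sieve⁻ : ∀ {x} → x ∈ sieve → In[1, L ] x × P x
  ∈-sieve⁻ x∈ with ∈-filter⁻ P? x∈
  ... | x∈oneTo , px = ∈-oneTo⁻ x∈oneTo , px

  sieve-In : All In[1, L ] sieve
  sieve-In = All.tabulate (λ x∈ → proj₁ (∈-sieve⁻ x∈))

  sieve-positive : All (0 <_) sieve
  sieve-positive = All.map proj₁ sieve-In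

  largest-sieve : 1 ≤ L → P L → largest sieve ≡ L
  largest-sieve 1≤L pL = ≤-antisym (largest≤ (All.map proj₂ sieve-In)) (∈⇒≤largest (∈-sieve⁺ (1≤L , ≤-refl) pL))

  private
    if∈sieve : ∀ (f : ℕ → ℕ) x → In[1, L ] x → (if? x ∈? sieve then f x) ≡ (if? P? x then f x)
    if∈sieve f x x∈ with x ∈? sieve | P? x
    ... | yes _  | yes _  = refl
    ... | no _   | no _   = refl
    ... | yes x∈s | no ¬px = ⊥-elim (¬px (proj₂ (∈-sieve⁻ x∈s)))
    ... | no x∉s | yes px = ⊥-elim (x∉s (∈-sieve⁺ x∈ px))

  sum-sieve : sum sieve ≡ ∑ (λ x → if? P? x then x) L
  sum-sieve = trans (sum≡∑ sieve sieve-increasing sieve-In) (∑-cong L (if∈sieve (λ x → x)))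

  length-sieve : length sieve ≡ ∑ (λ x → if? P? x then 1) L
  length-sieve = trans (length≡∑ sieve sieve-increasing sieve-In) (∑-cong L (if∈sieve (λ _ → 1)))

-- Unrefinable partitions and their largest part

T≡tri∸ : ∀ n d → T n d ≡ tri n ∸ d
T≡tri∸ n d = cong (_∸ d) (trans (cong (_/ 2) (sym (2*tri n))) (m*n/n≡m (tri n) 2))
  where
  2*tri : ∀ n → tri n * 2 ≡ n * suc n
  2*tri zero    = refl
  2*tri (suc n) rewrite *-distribʳ-+ 2 (tri n) (suc n) | 2*tri n = solve (n ∷ [])

length-π : ∀ n d → In[1, n ] d → suc (length (π n d)) ≡ n
length-π n d d∈ = begin
    suc (length (π n d))
  ≡⟨ cong₂ _+_ (∑-indicator (λ _ → 1) n d d∈) (sym (length-sieve _ n)) ⟨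
    ∑ (λ x → if? x ≟ d then 1) n + ∑ (λ x → if? ¬? (x ≟ d) then 1) n
  ≡⟨ ∑-+ _ _ n ⟨
    ∑ (λ x → (if? x ≟ d then 1) + (if? ¬? (x ≟ d) then 1)) n
  ≡⟨ ∑-cong n (λ x _ → one x) ⟩
    ∑ (λ _ → 1) n
  ≡⟨ ∑-const1 n ⟩
    n
  ∎
  where
  open ≡-Reasoning
  one : ∀ x → (if? x ≟ d then 1) + (if? ¬? (x ≟ d) then 1) ≡ 1
  one x with x ≟ d
  ... | yes _ = refl
  ... | no _  = refl

h+length≡j+length-π : ∀ n d B λs → n ≤ B → Increasing λs → All In[1, B ] λs →
                      h n d λs + length λs ≡ j n d λs + length (π n d)
h+length≡j+length-π n d B λs n≤B λs↑ λs∈ =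
  ∣xs∖ys∣+∣ys∣≡∣ys∖xs∣+∣xs∣ (π n d) λs (sieve-increasing _ n) λs↑ π∈ λs∈
  where
  π∈ : All In[1, B ] (π n d)
  π∈ = All.map (λ (1≤x , x≤n) → 1≤x , ≤-trans x≤n n≤B) (sieve-In _ n)

module _ {N λs} (P : DistinctPartition N λs) where

  parts-In : All In[1, largest λs ] λs
  parts-In = All.tabulate (λ x∈ → All.lookup (positive P) x∈ , ∈⇒≤largest x∈)

  largest∈parts : largest λs ∈ λs
  largest∈parts = largest∈ (≤-trans (s≤s z≤n) (twoParts P))

  N≡∑parts : N ≡ ∑ (λ x → if? x ∈? λs then x) (largest λs)
  N≡∑parts = trans (sym (sums P)) (sum≡∑ λs (increasing P) parts-In)

unrefinable-pair : ∀ {λs} → Unrefinable λs → largest λs ∈ λs → ∀ a → 1 ≤ a → a + a < largest λs →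
                   a ∈ λs ⊎ largest λs ∸ a ∈ λs
unrefinable-pair {λs} U L∈ a 1≤a 2a<L with a ∈? λs | largest λs ∸ a ∈? λs
... | yes a∈ | _      = inj₁ a∈
... | no _   | yes b∈ = inj₂ b∈
... | no a∉  | no b∉  =
  contradiction (a , L ∸ a , a≢L∸a , (1≤a , a≤L , a∉) , (1≤L∸a , m∸n≤m L a , b∉) , a+[L∸a]∈) U
  where
  L = largest λs
  a≤L : a ≤ L
  a≤L = ≤-trans (m≤m+n a a) (<⇒≤ 2a<L)
  a≢L∸a : a ≢ L ∸ a
  a≢L∸a eq = <-irrefl (trans (cong (a +_) eq) (m+[n∸m]≡n a≤L)) 2a<L
  1≤L∸a : 1 ≤ L ∸ a
  1≤L∸a = m<n⇒0<n∸m (≤-trans (s≤s (m≤m+n a a)) 2a<L)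
  a+[L∸a]∈ : a + (L ∸ a) ∈ λs
  a+[L∸a]∈ = subst (_∈ λs) (sym (m+[n∸m]≡n a≤L)) L∈

tri+largest≤ : ∀ {N μ} → InU N μ → ∀ q → q + q < largest μ → tri q + largest μ ≤ N
tri+largest≤ {N} {μ} (P , U) q 2q<L = begin
    tri q + L                          ≤⟨ +-monoˡ-≤ L (∑-mono-≤ q pair≥) ⟩
    ∑ (λ a → F a + F (L ∸ a)) q + L    ≡⟨ cong (∑ (λ a → F a + F (L ∸ a)) q +_) (if?-yes (L ∈? μ) (largest∈parts P)) ⟨
    ∑ (λ a → F a + F (L ∸ a)) q + F L  ≤⟨ ∑-pairs≤∑ F q L 2q<L ⟩
    ∑ F L                              ≡⟨ N≡∑parts P ⟨
    N                                  ∎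
  where
  open ≤-Reasoning
  L = largest μ
  F : ℕ → ℕ
  F x = if? x ∈? μ then x
  2a<L : ∀ {a} → a ≤ q → a + a < L
  2a<L a≤q = ≤-<-trans (+-mono-≤ a≤q a≤q) 2q<L
  pair≥ : ∀ a → In[1, q ] a → a ≤ F a + F (L ∸ a)
  pair≥ a (1≤a , a≤q) with unrefinable-pair U (largest∈parts P) a 1≤a (2a<L a≤q)
  ... | inj₁ a∈ rewrite if?-yes (a ∈? μ) {a} a∈ = m≤m+n a _
  ... | inj₂ b∈ rewrite if?-yes (L ∸ a ∈? μ) {L ∸ a} b∈ = ≤-trans (m+n≤o⇒m≤o∸n a (<⇒≤ (2a<L a≤q))) (m≤n+m _ _)

largest-unrefinable≤ : ∀ q d μ → 3 ≤ d → InU (T (suc (suc q)) d) μ → largest μ ≤ q + q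
largest-unrefinable≤ q d μ 3≤d μ∈U with largest μ ≤? q + q
... | yes L≤2q = L≤2q
... | no L≰2q  = contradiction (tri+largest≤ μ∈U q (≰⇒> L≰2q)) (<⇒≱ (begin-strict
    T (suc (suc q)) d          ≡⟨ T≡tri∸ (suc (suc q)) d ⟩
    tri (suc (suc q)) ∸ d      ≤⟨ ∸-monoʳ-≤ (tri (suc (suc q))) 3≤d ⟩
    tri (suc (suc q)) ∸ 3      ≡⟨ cong (_∸ 3) (rearrange (tri q)) ⟩
    3 + (tri q + (q + q)) ∸ 3  ≡⟨ m+n∸m≡n 3 _ ⟩
    tri q + (q + q)            <⟨ +-monoʳ-< (tri q) (≰⇒> L≰2q) ⟩
    tri q + largest μ          ∎))
  where
  open ≤-Reasoning
  rearrange : ∀ t → t + suc q + suc (suc q) ≡ 3 + (t + (q + q))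
  rearrange t = solve (t ∷ q ∷ [])

-- Pairing the parts around 2n − 4

-- With n = q + 3 this is the largest part 2n − 4; the shape q + (1 + (q + 1)) lets
-- ∑-foldEnds split 1‥λₜ q into pairs around the single middle term q + 1.
λₜ : ℕ → ℕ
λₜ q = q + (1 + suc q)

λₜ≡ : ∀ q → λₜ q ≡ suc q + suc q
λₜ≡ q = +-suc q (suc q)

λₜ≡2*[1+q] : ∀ q → λₜ q ≡ 2 * suc q
λₜ≡2*[1+q] q = trans (λₜ≡ q) (cong (suc q +_) (sym (+-identityʳ (suc q))))

q+q<λₜ : ∀ q → q + q < λₜ q
q+q<λₜ q = +-monoʳ-< q (m<n⇒m<1+n (n<1+n q))

3+q≤λₜ : ∀ {q} → 1 ≤ q → 3 + q ≤ λₜ q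
3+q≤λₜ {q} 1≤q = subst (_≤ λₜ q) (+-comm q 3) (+-monoʳ-≤ q (s≤s (s≤s 1≤q)))

λₜ∸a : ∀ q a → a ≤ q → λₜ q ∸ a ≡ suc q + (suc q ∸ a)
λₜ∸a q a a≤q = trans (cong (_∸ a) (λₜ≡ q)) (+-∸-assoc (suc q) (m≤n⇒m≤1+n a≤q))

2n∸4≡λₜ : ∀ q → 2 * (3 + q) ∸ 4 ≡ λₜ q
2n∸4≡λₜ q = trans (cong (_∸ 4) 2n≡4+λₜ) (m+n∸m≡n 4 (λₜ q))
  where
  2n≡4+λₜ : 2 * (3 + q) ≡ 4 + (q + (1 + suc q))
  2n≡4+λₜ = solve (q ∷ [])

T+d≡ : ∀ q d → d ≤ 3 + q → T (3 + q) d + d ≡ tri q + λₜ q + (q + 4)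
T+d≡ q d d≤n = begin
    T (3 + q) d + d        ≡⟨ cong (_+ d) (T≡tri∸ (3 + q) d) ⟩
    tri (3 + q) ∸ d + d    ≡⟨ m∸n+n≡m (≤-trans d≤n (m≤n+m (3 + q) _)) ⟩
    tri (3 + q)            ≡⟨ rearrange (tri q) ⟩
    tri q + λₜ q + (q + 4) ∎
  where
  open ≡-Reasoning
  rearrange : ∀ t → t + suc q + suc (suc q) + suc (suc (suc q)) ≡ t + (q + (1 + suc q)) + (q + 4)
  rearrange t = solve (t ∷ q ∷ [])

module PairDecomposition (λs : List ℕ) (q : ℕ) where

  weigh : (ℕ → ℕ) → ℕ → ℕ
  weigh w x = if? x ∈? λs then w x

  -- For 1 ≤ a ≤ q, how much the pair {a, λₜ q − a} contributes to the sum (resp. the number of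
  -- parts) beyond a (resp. 1); the truncated subtraction is only meaningful when the pair meets λs.
  excess : ℕ → ℕ
  excess a = weigh (λ x → x) a + weigh (λ x → x) (λₜ q ∸ a) ∸ a

  doubled : ℕ → ℕ
  doubled a = weigh (λ _ → 1) a + weigh (λ _ → 1) (λₜ q ∸ a) ∸ 1

  data PairShape (a : ℕ) : Set where
    lower : a ∈ λs → λₜ q ∸ a ∉ λs → PairShape a
    upper : a ∉ λs → λₜ q ∸ a ∈ λs → PairShape a
    both  : a ∈ λs → λₜ q ∸ a ∈ λs → PairShape a

  Paired : Set
  Paired = ∀ a → In[1, q ] a → a ∈ λs ⊎ λₜ q ∸ a ∈ λs

  pairShape : Paired → ∀ a → In[1, q ] a → PairShape a
  pairShape paired a a∈ with a ∈? λs | λₜ q ∸ a ∈? λs | paired a a∈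
  ... | yes a∈λs | yes b∈λs | _        = both a∈λs b∈λs
  ... | yes a∈λs | no b∉λs  | _        = lower a∈λs b∉λs
  ... | no a∉λs  | yes b∈λs | _        = upper a∉λs b∈λs
  ... | no a∉λs  | no _     | inj₁ a∈λs = contradiction a∈λs a∉λs
  ... | no _     | no b∉λs  | inj₂ b∈λs = contradiction b∈λs b∉λs

  private
    weigh-∈ : ∀ w {x} → x ∈ λs → weigh w x ≡ w x
    weigh-∈ w x∈ = if?-yes (_ ∈? λs) x∈
    weigh-∉ : ∀ w {x} → x ∉ λs → weigh w x ≡ 0
    weigh-∉ w x∉ = if?-no (_ ∈? λs) x∉

  excess-lower : ∀ {a} → a ∈ λs → λₜ q ∸ a ∉ λs → excess a ≡ 0
  excess-lower {a} a∈ b∉ rewrite weigh-∈ (λ x → x) a∈ | weigh-∉ (λ x → x) b∉ | +-identityʳ a = n∸n≡0 a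

  excess-upper : ∀ {a} → a ∉ λs → λₜ q ∸ a ∈ λs → excess a ≡ 2 * (suc q ∸ a)
  excess-upper {a} a∉ b∈ rewrite weigh-∉ (λ x → x) a∉ | weigh-∈ (λ x → x) b∈ = begin
      λₜ q ∸ a ∸ a         ≡⟨ ∸-+-assoc (λₜ q) a a ⟩
      λₜ q ∸ (a + a)       ≡⟨ cong₂ _∸_ (λₜ≡2*[1+q] q) (cong (a +_) (sym (+-identityʳ a))) ⟩
      2 * suc q ∸ 2 * a    ≡⟨ *-distribˡ-∸ 2 (suc q) a ⟨
      2 * (suc q ∸ a)      ∎
    where open ≡-Reasoning

  excess-both : ∀ {a} → a ≤ q → a ∈ λs → λₜ q ∸ a ∈ λs → suc (suc q) ≤ excess a
  excess-both {a} a≤q a∈ b∈ rewrite weigh-∈ (λ x → x) a∈ | weigh-∈ (λ x → x) b∈ | m+n∸m≡n a (λₜ q ∸ a) =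
    subst (_≤ λₜ q ∸ a) (m+n∸m≡n q (1 + suc q)) (∸-monoʳ-≤ (λₜ q) a≤q)

  doubled-lower : ∀ {a} → a ∈ λs → λₜ q ∸ a ∉ λs → doubled a ≡ 0
  doubled-lower a∈ b∉ rewrite weigh-∈ (λ _ → 1) a∈ | weigh-∉ (λ _ → 1) b∉ = refl

  doubled-upper : ∀ {a} → a ∉ λs → λₜ q ∸ a ∈ λs → doubled a ≡ 0
  doubled-upper a∉ b∈ rewrite weigh-∉ (λ _ → 1) a∉ | weigh-∈ (λ _ → 1) b∈ = refl

  doubled-both : ∀ {a} → a ∈ λs → λₜ q ∸ a ∈ λs → doubled a ≡ 1
  doubled-both a∈ b∈ rewrite weigh-∈ (λ _ → 1) a∈ | weigh-∈ (λ _ → 1) b∈ = refl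

  module _ (λs↑ : Increasing λs) (λs∈ : All In[1, λₜ q ] λs) (top∈ : λₜ q ∈ λs) (paired : Paired) where

    private
      ∑-weigh : ∀ w → ∑ (weigh w) (λₜ q) ≡ ∑ (λ a → weigh w a + weigh w (λₜ q ∸ a)) q + weigh w (suc q) + w (λₜ q)
      ∑-weigh w = begin
          ∑ W (λₜ q)
        ≡⟨ ∑-foldEnds W q 1 ⟩
          ∑ W q + (0 + W (q + 1)) + ∑ (λ a → W (λₜ q ∸ a)) q + W (λₜ q)
        ≡⟨ cong₂ (λ m t → ∑ W q + m + ∑ (λ a → W (λₜ q ∸ a)) q + t) (cong W (+-comm q 1)) (weigh-∈ w top∈) ⟩
          ∑ W q + W (suc q) + ∑ (λ a → W (λₜ q ∸ a)) q + w (λₜ q)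
        ≡⟨ cong (_+ w (λₜ q)) (+-comm-middle (∑ W q) (W (suc q)) _) ⟩
          ∑ W q + ∑ (λ a → W (λₜ q ∸ a)) q + W (suc q) + w (λₜ q)
        ≡⟨ cong (λ s → s + W (suc q) + w (λₜ q)) (∑-+ W _ q) ⟨
          ∑ (λ a → W a + W (λₜ q ∸ a)) q + W (suc q) + w (λₜ q)
        ∎
        where
        open ≡-Reasoning
        W = weigh w
        +-comm-middle : ∀ a b c → a + b + c ≡ a + c + b
        +-comm-middle a b c = solve (a ∷ b ∷ c ∷ [])

      a≤pair : ∀ a → In[1, q ] a → a ≤ weigh (λ x → x) a + weigh (λ x → x) (λₜ q ∸ a)
      a≤pair a a∈@(_ , a≤q) with pairShape paired a a∈
      ... | lower a∈λs _ rewrite weigh-∈ (λ x → x) a∈λs = m≤m+n a _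
      ... | both a∈λs _  rewrite weigh-∈ (λ x → x) a∈λs = m≤m+n a _
      ... | upper _ b∈λs rewrite weigh-∈ (λ x → x) b∈λs =
        ≤-trans (subst (a ≤_) (sym (λₜ∸a q a a≤q)) (≤-trans (m≤n⇒m≤1+n a≤q) (m≤m+n _ _))) (m≤n+m _ _)

      1≤pair : ∀ a → In[1, q ] a → 1 ≤ weigh (λ _ → 1) a + weigh (λ _ → 1) (λₜ q ∸ a)
      1≤pair a a∈ with pairShape paired a a∈
      ... | lower a∈λs _ rewrite weigh-∈ (λ _ → 1) a∈λs = s≤s z≤n
      ... | both a∈λs _  rewrite weigh-∈ (λ _ → 1) a∈λs = s≤s z≤n
      ... | upper _ b∈λs rewrite weigh-∈ (λ _ → 1) b∈λs = m≤n+m 1 _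

    sum≡tri+∑excess : sum λs ≡ tri q + ∑ excess q + weigh (λ x → x) (suc q) + λₜ q
    sum≡tri+∑excess = begin
        sum λs
      ≡⟨ sum≡∑ λs λs↑ λs∈ ⟩
        ∑ (weigh (λ x → x)) (λₜ q)
      ≡⟨ ∑-weigh (λ x → x) ⟩
        ∑ (λ a → F a + F (λₜ q ∸ a)) q + F (suc q) + λₜ q
      ≡⟨ cong (λ s → s + F (suc q) + λₜ q) (∑-cong q (λ a a∈ → sym (m+[n∸m]≡n (a≤pair a a∈)))) ⟩
        ∑ (λ a → a + excess a) q + F (suc q) + λₜ q
      ≡⟨ cong (λ s → s + F (suc q) + λₜ q) (∑-+ (λ a → a) excess q) ⟩
        tri q + ∑ excess q + F (suc q) + λₜ q
      ∎
      where
      open ≡-Reasoning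
      F = weigh (λ x → x)

    length≡q+∑doubled : length λs ≡ q + ∑ doubled q + weigh (λ _ → 1) (suc q) + 1
    length≡q+∑doubled = begin
        length λs
      ≡⟨ length≡∑ λs λs↑ λs∈ ⟩
        ∑ (weigh (λ _ → 1)) (λₜ q)
      ≡⟨ ∑-weigh (λ _ → 1) ⟩
        ∑ (λ a → G a + G (λₜ q ∸ a)) q + G (suc q) + 1
      ≡⟨ cong (λ s → s + G (suc q) + 1) (∑-cong q (λ a a∈ → sym (m+[n∸m]≡n (1≤pair a a∈)))) ⟩
        ∑ (λ a → 1 + doubled a) q + G (suc q) + 1
      ≡⟨ cong (λ s → s + G (suc q) + 1) (trans (∑-+ (λ _ → 1) doubled q) (cong (_+ ∑ doubled q) (∑-const1 q))) ⟩
        q + ∑ doubled q + G (suc q) + 1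
      ∎
      where
      open ≡-Reasoning
      G = weigh (λ _ → 1)

  module _ (paired : Paired) where

    ∑doubled≡0⇒2∣∑excess : ∑ doubled q ≡ 0 → 2 ∣ ∑ excess q
    ∑doubled≡0⇒2∣∑excess ∑≡0 = 2∣∑ excess q even
      where
      even : ∀ a → In[1, q ] a → 2 ∣ excess a
      even a a∈@(_ , a≤q) with pairShape paired a a∈
      ... | lower a∈λs b∉λs = subst (2 ∣_) (sym (excess-lower a∈λs b∉λs)) (2 ∣0)
      ... | upper a∉λs b∈λs = subst (2 ∣_) (sym (excess-upper a∉λs b∈λs)) (m∣m*n (suc q ∸ a))
      ... | both a∈λs b∈λs = contradiction (trans (sym (doubled-both a∈λs b∈λs)) (∑≡0⇒f≡0 doubled q ∑≡0 a a∈)) λ ()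

    ∑excess≡0⇒lower : ∑ excess q ≡ 0 → ∀ a → In[1, q ] a → a ∈ λs × λₜ q ∸ a ∉ λs
    ∑excess≡0⇒lower ∑≡0 a a∈@(_ , a≤q) with pairShape paired a a∈ | ∑≡0⇒f≡0 excess q ∑≡0 a a∈
    ... | lower a∈λs b∉λs | _ = a∈λs , b∉λs
    ... | upper a∉λs b∈λs | e≡0 = contradiction (trans (sym (excess-upper a∉λs b∈λs)) e≡0) (>⇒≢ 2*[1+q∸a]>0)
      where
      2*[1+q∸a]>0 : 0 < 2 * (suc q ∸ a)
      2*[1+q∸a]>0 = <-≤-trans (m<n⇒0<n∸m (s≤s a≤q)) (m≤m+n _ _)
    ... | both a∈λs b∈λs  | e≡0 = contradiction (≤-trans (excess-both a≤q a∈λs b∈λs) (≤-reflexive e≡0)) λ ()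

    ∑doubled>0⇒∑excess≥ : 0 < ∑ doubled q → suc (suc q) ≤ ∑ excess q
    ∑doubled>0⇒∑excess≥ ∑>0 with a , a∈@(_ , a≤q) , d>0 ← ∑>0⇒∃f>0 doubled q ∑>0
      = ≤-trans (large (pairShape paired a a∈)) (f≤∑ excess q a a∈)
      where
      large : PairShape a → suc (suc q) ≤ excess a
      large (both a∈λs b∈λs)  = excess-both a≤q a∈λs b∈λs
      large (lower a∈λs b∉λs) = contradiction (doubled-lower a∈λs b∉λs) (>⇒≢ d>0)
      large (upper a∉λs b∈λs) = contradiction (doubled-upper a∉λs b∈λs) (>⇒≢ d>0)

-- An initial segment with one large part

private
  3+r+r≡ : ∀ r → 3 + (r + r) ≡ suc r + suc (suc r)
  3+r+r≡ r = solve (r ∷ [])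

3+r+r≤a+b : ∀ {r a b} → r < a → r < b → a ≢ b → 3 + (r + r) ≤ a + b
3+r+r≤a+b {r} {a} {b} r<a r<b a≢b with <-cmp a b
... | tri< a<b _ _ = ≤-trans (≤-reflexive (3+r+r≡ r)) (+-mono-≤ r<a (≤-trans (s≤s r<a) a<b))
... | tri≈ _ a≡b _ = contradiction a≡b a≢b
... | tri> _ _ b<a = ≤-trans (≤-reflexive (3+r+r≡ r)) (≤-trans (+-mono-≤ r<b (≤-trans (s≤s r<b) b<a)) (≤-reflexive (+-comm b a)))

module InitialSegment (r s : ℕ) (1≤r : 1 ≤ r) where

  top : ℕ
  top = r + suc s

  InitialOrTop : ℕ → Set
  InitialOrTop x = x ≤ r ⊎ x ≡ top

  parts : List ℕ
  parts = sieve (λ x → x ≤? r ⊎-dec x ≟ top) top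

  r≤top : r ≤ top
  r≤top = m≤m+n r _

  ∈-parts⁺ : ∀ {x} → In[1, top ] x → InitialOrTop x → x ∈ parts
  ∈-parts⁺ = ∈-sieve⁺ _ top

  ∈-parts⁻ : ∀ {x} → x ∈ parts → In[1, top ] x × InitialOrTop x
  ∈-parts⁻ = ∈-sieve⁻ _ top

  parts-increasing : Increasing parts
  parts-increasing = sieve-increasing _ top

  parts-within : All In[1, top ] parts
  parts-within = sieve-In _ top

  largest-parts : largest parts ≡ top
  largest-parts = largest-sieve _ top (≤-trans 1≤r r≤top) (inj₂ refl)

  private
    ∑-parts : ∀ (w : ℕ → ℕ) → ∑ (λ x → if? x ≤? r ⊎-dec x ≟ top then w x) top ≡ ∑ w r + w top
    ∑-parts w = begin
        ∑ W (r + suc s)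
      ≡⟨ ∑-split W r (suc s) ⟩
        ∑ W r + (∑ (λ i → W (r + i)) s + W top)
      ≡⟨ cong₂ (λ u v → u + (v + W top)) (∑-cong r initial) (∑-zero _ s gap) ⟩
        ∑ w r + (0 + W top)
      ≡⟨ cong (∑ w r +_) (if?-yes (top ≤? r ⊎-dec top ≟ top) (inj₂ refl)) ⟩
        ∑ w r + w top
      ∎
      where
      open ≡-Reasoning
      W : ℕ → ℕ
      W x = if? x ≤? r ⊎-dec x ≟ top then w x
      initial : ∀ x → In[1, r ] x → W x ≡ w x
      initial x (_ , x≤r) = if?-yes (x ≤? r ⊎-dec x ≟ top) (inj₁ x≤r)
      gap : ∀ i → In[1, s ] i → W (r + i) ≡ 0
      gap i (1≤i , i≤s) = if?-no (r + i ≤? r ⊎-dec r + i ≟ top) excluded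
        where
        excluded : ¬ InitialOrTop (r + i)
        excluded (inj₁ r+i≤r) = <⇒≱ (subst (_< r + i) (+-identityʳ r) (+-monoʳ-< r 1≤i)) r+i≤r
        excluded (inj₂ r+i≡top) = <-irrefl (+-cancelˡ-≡ r i (suc s) r+i≡top) (s≤s i≤s)

  sum-parts : sum parts ≡ tri r + top
  sum-parts = trans (sum-sieve _ top) (∑-parts (λ x → x))

  length-parts : length parts ≡ r + 1
  length-parts = trans (length-sieve _ top) (trans (∑-parts (λ _ → 1)) (cong (_+ 1) (∑-const1 r)))

  unrefinable-parts : s ≤ suc r → Unrefinable parts
  unrefinable-parts s≤1+r (a , b , a≢b , a-missing , b-missing , a+b∈) = <⇒≱ top<a+b a+b≤top
    where
    a+b≤top : a + b ≤ top
    a+b≤top = proj₂ (proj₁ (∈-parts⁻ a+b∈))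
    above : ∀ {x} → Missing parts x → r < x
    above {x} (1≤x , x≤L , x∉) with x ≤? r
    ... | yes x≤r = contradiction (∈-parts⁺ (1≤x , subst (x ≤_) largest-parts x≤L) (inj₁ x≤r)) x∉
    ... | no x≰r  = ≰⇒> x≰r
    top<a+b : top < a + b
    top<a+b = begin-strict
      r + suc s        ≤⟨ +-monoʳ-≤ r (s≤s s≤1+r) ⟩
      r + suc (suc r)  ≡⟨ solve (r ∷ []) ⟩
      2 + (r + r)      <⟨ n<1+n _ ⟩
      3 + (r + r)      ≤⟨ 3+r+r≤a+b (above a-missing) (above b-missing) a≢b ⟩
      a + b            ∎
      where open ≤-Reasoning

  parts∈U : ∀ {N} → s ≤ suc r → N ≡ tri r + top → InU N parts
  parts∈U s≤1+r N≡ = record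
    { increasing = parts-increasing
    ; positive   = sieve-positive _ top
    ; sums       = trans sum-parts (sym N≡)
    ; twoParts   = 2≤length parts (∈-parts⁺ (≤-refl , ≤-trans 1≤r r≤top) (inj₁ 1≤r))
                                  (∈-parts⁺ (≤-trans 1≤r r≤top , ≤-refl) (inj₂ refl))
                                  (<⇒≢ (≤-trans (s≤s 1≤r) (subst (suc r ≤_) (sym (+-suc r s)) (s≤s (m≤m+n r s)))))
    } , unrefinable-parts s≤1+r

-- Swapping small parts p for 2n − 4 − p

record Swappable (q p₁ p₂ : ℕ) : Set where
  field
    p₁∈ : In[1, q ] p₁
    p₂∈ : In[1, q ] p₂
    1+q<p₁+p₁ : suc q < p₁ + p₁
    1+q<p₂+p₂ : suc q < p₂ + p₂
    1+q<p₁+p₂ : suc q < p₁ + p₂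
    p₁+p₂+p₁≢λₜ : p₁ + p₂ + p₁ ≢ λₜ q
    p₁+p₂+p₂≢λₜ : p₁ + p₂ + p₂ ≢ λₜ q

module Swapped {q p₁ p₂ : ℕ} (S : Swappable q p₁ p₂) where
  open Swappable S

  IsSwapped : ℕ → Set
  IsSwapped a = a ≡ p₁ ⊎ a ≡ p₂

  swapped? : (a : ℕ) → Dec (IsSwapped a)
  swapped? a = a ≟ p₁ ⊎-dec a ≟ p₂

  IsPart : ℕ → Set
  IsPart x = (x ≤ q × ¬ IsSwapped x) ⊎ (x ≡ λₜ q ∸ p₁ ⊎ (x ≡ λₜ q ∸ p₂ ⊎ x ≡ λₜ q))

  parts : List ℕ
  parts = sieve (λ x → (x ≤? q ×-dec ¬? (swapped? x))
                       ⊎-dec (x ≟ λₜ q ∸ p₁ ⊎-dec (x ≟ λₜ q ∸ p₂ ⊎-dec x ≟ λₜ q)))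
                (λₜ q)

  ∈-parts⁺ : ∀ {x} → In[1, λₜ q ] x → IsPart x → x ∈ parts
  ∈-parts⁺ = ∈-sieve⁺ _ (λₜ q)

  ∈-parts⁻ : ∀ {x} → x ∈ parts → In[1, λₜ q ] x × IsPart x
  ∈-parts⁻ = ∈-sieve⁻ _ (λₜ q)

  ≤λₜ : ∀ {a} → a ≤ q → a ≤ λₜ q
  ≤λₜ a≤q = ≤-trans a≤q (m≤m+n _ _)

  parts-increasing : Increasing parts
  parts-increasing = sieve-increasing _ (λₜ q)

  parts-within : All In[1, λₜ q ] parts
  parts-within = sieve-In _ (λₜ q)

  q<λₜ∸ : ∀ {a} → a ≤ q → suc q < λₜ q ∸ a
  q<λₜ∸ {a} a≤q = subst (suc q <_) (sym (λₜ∸a q a a≤q)) (m<m+n (suc q) (m<n⇒0<n∸m (s≤s a≤q)))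

  swapped≤q : ∀ {a} → IsSwapped a → a ≤ q
  swapped≤q (inj₁ refl) = proj₂ p₁∈
  swapped≤q (inj₂ refl) = proj₂ p₂∈

  1≤λₜ : 1 ≤ λₜ q
  1≤λₜ = ≤-trans (s≤s z≤n) (m≤n+m (1 + suc q) q)

  largest-parts : largest parts ≡ λₜ q
  largest-parts = largest-sieve _ (λₜ q) 1≤λₜ (inj₂ (inj₂ (inj₂ refl)))

  λₜ∈parts : λₜ q ∈ parts
  λₜ∈parts = ∈-parts⁺ (1≤λₜ , ≤-refl) (inj₂ (inj₂ (inj₂ refl)))

  ∈-parts-small : ∀ {a} → In[1, q ] a → ¬ IsSwapped a → a ∈ parts
  ∈-parts-small (1≤a , a≤q) a-kept = ∈-parts⁺ (1≤a , ≤-trans a≤q (m≤m+n q _)) (inj₁ (a≤q , a-kept))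

  ∉-parts-small : ∀ {a} → a ≤ q → IsSwapped a → a ∉ parts
  ∉-parts-small a≤q a-swapped a∈ with proj₂ (∈-parts⁻ a∈)
  ... | inj₁ (_ , a-kept)       = a-kept a-swapped
  ... | inj₂ (inj₁ refl)        = <⇒≱ (q<λₜ∸ (proj₂ p₁∈)) (m≤n⇒m≤1+n a≤q)
  ... | inj₂ (inj₂ (inj₁ refl)) = <⇒≱ (q<λₜ∸ (proj₂ p₂∈)) (m≤n⇒m≤1+n a≤q)
  ... | inj₂ (inj₂ (inj₂ refl)) = <⇒≱ (q<λₜ∸ z≤n) (m≤n⇒m≤1+n a≤q)

  λₜ∸-In : ∀ {a} → a ≤ q → In[1, λₜ q ] (λₜ q ∸ a)
  λₜ∸-In {a} a≤q = ≤-trans (s≤s z≤n) (q<λₜ∸ a≤q) , m∸n≤m (λₜ q) a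

  ∈-parts-large : ∀ {a} → a ≤ q → IsSwapped a → λₜ q ∸ a ∈ parts
  ∈-parts-large a≤q (inj₁ refl) = ∈-parts⁺ (λₜ∸-In a≤q) (inj₂ (inj₁ refl))
  ∈-parts-large a≤q (inj₂ refl) = ∈-parts⁺ (λₜ∸-In a≤q) (inj₂ (inj₂ (inj₁ refl)))

  ∉-parts-large : ∀ {a} → In[1, q ] a → ¬ IsSwapped a → λₜ q ∸ a ∉ parts
  ∉-parts-large {a} (1≤a , a≤q) a-kept b∈ with proj₂ (∈-parts⁻ b∈)
  ... | inj₁ (b≤q , _)          = <⇒≱ (q<λₜ∸ a≤q) (m≤n⇒m≤1+n b≤q)
  ... | inj₂ (inj₁ eq)          = a-kept (inj₁ (∸-cancelˡ-≡ (≤λₜ a≤q) (≤λₜ (proj₂ p₁∈)) eq))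
  ... | inj₂ (inj₂ (inj₁ eq))   = a-kept (inj₂ (∸-cancelˡ-≡ (≤λₜ a≤q) (≤λₜ (proj₂ p₂∈)) eq))
  ... | inj₂ (inj₂ (inj₂ eq))   = <⇒≢ (∸-monoʳ-< 1≤a (≤λₜ a≤q)) eq

  1+q∉parts : suc q ∉ parts
  1+q∉parts 1+q∈ with proj₂ (∈-parts⁻ 1+q∈)
  ... | inj₁ (1+q≤q , _)       = <-irrefl refl 1+q≤q
  ... | inj₂ (inj₁ eq)          = <-irrefl eq (q<λₜ∸ (proj₂ p₁∈))
  ... | inj₂ (inj₂ (inj₁ eq))   = <-irrefl eq (q<λₜ∸ (proj₂ p₂∈))
  ... | inj₂ (inj₂ (inj₂ eq))   = <-irrefl eq (q<λₜ∸ z≤n)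

  open PairDecomposition parts q

  paired : Paired
  paired a a∈ with swapped? a
  ... | yes a-swapped = inj₂ (∈-parts-large (proj₂ a∈) a-swapped)
  ... | no a-kept     = inj₁ (∈-parts-small a∈ a-kept)

  excess-parts : ∀ a → In[1, q ] a → excess a ≡ (if? swapped? a then 2 * (suc q ∸ a))
  excess-parts a a∈@(_ , a≤q) with swapped? a
  ... | yes a-swapped = excess-upper (∉-parts-small a≤q a-swapped) (∈-parts-large a≤q a-swapped)
  ... | no a-kept     = excess-lower (∈-parts-small a∈ a-kept) (∉-parts-large a∈ a-kept)

  doubled-parts : ∀ a → In[1, q ] a → doubled a ≡ 0
  doubled-parts a a∈@(_ , a≤q) with swapped? a
  ... | yes a-swapped = doubled-upper (∉-parts-small a≤q a-swapped) (∈-parts-large a≤q a-swapped)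
  ... | no a-kept     = doubled-lower (∈-parts-small a∈ a-kept) (∉-parts-large a∈ a-kept)

  swapGain : ℕ
  swapGain = ∑ (λ a → if? swapped? a then 2 * (suc q ∸ a)) q

  sum-parts : sum parts ≡ tri q + swapGain + λₜ q
  sum-parts = begin
      sum parts
    ≡⟨ sum≡tri+∑excess parts-increasing parts-within λₜ∈parts paired ⟩
      tri q + ∑ excess q + weigh (λ x → x) (suc q) + λₜ q
    ≡⟨ cong₂ (λ e m → tri q + e + m + λₜ q) (∑-cong q excess-parts) (if?-no (suc q ∈? parts) 1+q∉parts) ⟩
      tri q + swapGain + 0 + λₜ q
    ≡⟨ cong (_+ λₜ q) (+-identityʳ (tri q + swapGain)) ⟩
      tri q + swapGain + λₜ q
    ∎
    where open ≡-Reasoning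

  length-parts : length parts ≡ suc q
  length-parts = begin
      length parts
    ≡⟨ length≡q+∑doubled parts-increasing parts-within λₜ∈parts paired ⟩
      q + ∑ doubled q + weigh (λ _ → 1) (suc q) + 1
    ≡⟨ cong₂ (λ e m → q + e + m + 1) (∑-zero doubled q doubled-parts) (if?-no (suc q ∈? parts) 1+q∉parts) ⟩
      q + 0 + 0 + 1
    ≡⟨ solve (q ∷ []) ⟩
      suc q
    ∎
    where open ≡-Reasoning

  private
    swapped-sum : ∀ {x y} → IsSwapped x → IsSwapped y → suc q < x + y
    swapped-sum (inj₁ refl) (inj₁ refl) = 1+q<p₁+p₁
    swapped-sum (inj₁ refl) (inj₂ refl) = 1+q<p₁+p₂
    swapped-sum (inj₂ refl) (inj₁ refl) = subst (suc q <_) (+-comm p₁ p₂) 1+q<p₁+p₂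
    swapped-sum (inj₂ refl) (inj₂ refl) = 1+q<p₂+p₂

    HighMissing : ℕ → Set
    HighMissing x = suc q ≤ x × x ≢ λₜ q ∸ p₁ × x ≢ λₜ q ∸ p₂

    missing-kind : ∀ {x} → Missing parts x → IsSwapped x ⊎ HighMissing x
    missing-kind {x} (1≤x , x≤L , x∉) with x ≤? q | swapped? x
    ... | yes x≤q | yes x-swapped = inj₁ x-swapped
    ... | yes x≤q | no x-kept     = contradiction (∈-parts-small (1≤x , x≤q) x-kept) x∉
    ... | no x≰q  | _             = inj₂ (≰⇒> x≰q , (λ eq → x∉ (∈-parts⁺ x∈ (inj₂ (inj₁ eq))))
                                                   , (λ eq → x∉ (∈-parts⁺ x∈ (inj₂ (inj₂ (inj₁ eq))))))
      where
      x∈ : In[1, λₜ q ] x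
      x∈ = 1≤x , subst (x ≤_) largest-parts x≤L

    +p≡λₜ : ∀ {z p} → p ≤ q → z ≡ λₜ q ∸ p → z + p ≡ λₜ q
    +p≡λₜ p≤q refl = m∸n+n≡m (≤λₜ p≤q)

    two-swapped : ∀ {x y} → x ≢ y → IsSwapped x → IsSwapped y → x + y ∉ parts
    two-swapped {x} {y} x≢y x-sw y-sw x+y∈ with proj₂ (∈-parts⁻ x+y∈)
    ... | inj₁ (x+y≤q , _)        = <⇒≱ (swapped-sum x-sw y-sw) (m≤n⇒m≤1+n x+y≤q)
    ... | inj₂ (inj₂ (inj₂ eq))   = <-irrefl eq (≤-<-trans (+-mono-≤ (swapped≤q x-sw) (swapped≤q y-sw)) (q+q<λₜ q))
    ... | inj₂ (inj₁ eq)          = via-p₁ x-sw y-sw (+p≡λₜ (proj₂ p₁∈) eq)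
      where
      via-p₁ : IsSwapped x → IsSwapped y → x + y + p₁ ≢ λₜ q
      via-p₁ (inj₁ refl) (inj₁ refl) _  = x≢y refl
      via-p₁ (inj₂ refl) (inj₂ refl) _  = x≢y refl
      via-p₁ (inj₁ refl) (inj₂ refl) eq = p₁+p₂+p₁≢λₜ eq
      via-p₁ (inj₂ refl) (inj₁ refl) eq = p₁+p₂+p₁≢λₜ (trans (cong (_+ p₁) (+-comm p₁ p₂)) eq)
    ... | inj₂ (inj₂ (inj₁ eq))   = via-p₂ x-sw y-sw (+p≡λₜ (proj₂ p₂∈) eq)
      where
      via-p₂ : IsSwapped x → IsSwapped y → x + y + p₂ ≢ λₜ q
      via-p₂ (inj₁ refl) (inj₁ refl) _  = x≢y refl
      via-p₂ (inj₂ refl) (inj₂ refl) _  = x≢y refl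
      via-p₂ (inj₁ refl) (inj₂ refl) eq = p₁+p₂+p₂≢λₜ eq
      via-p₂ (inj₂ refl) (inj₁ refl) eq = p₁+p₂+p₂≢λₜ (trans (cong (_+ p₂) (+-comm p₁ p₂)) eq)

    small-partner : ∀ {x y p} → suc q ≤ y → x + y + p ≡ λₜ q → x + p ≤ suc q
    small-partner {x} {y} {p} 1+q≤y eq = +-cancelʳ-≤ (suc q) (x + p) (suc q) (begin
      x + p + suc q  ≤⟨ +-monoʳ-≤ (x + p) 1+q≤y ⟩
      x + p + y      ≡⟨ +-comm-middle x p y ⟩
      x + y + p      ≡⟨ eq ⟩
      λₜ q           ≡⟨ λₜ≡ q ⟩
      suc q + suc q  ∎)
      where
      open ≤-Reasoning
      +-comm-middle : ∀ a b c → a + b + c ≡ a + c + b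
      +-comm-middle a b c = solve (a ∷ b ∷ c ∷ [])

    swapped+high : ∀ {x y} → IsSwapped x → HighMissing y → x + y ∉ parts
    swapped+high {x} {y} x-sw (1+q≤y , y≢₁ , y≢₂) x+y∈ with proj₂ (∈-parts⁻ x+y∈)
    ... | inj₁ (x+y≤q , _)        = <⇒≱ (s≤s (m+n≤o⇒n≤o x x+y≤q)) 1+q≤y
    ... | inj₂ (inj₁ eq)          = <⇒≱ (swapped-sum x-sw (inj₁ refl)) (small-partner {x} 1+q≤y (+p≡λₜ (proj₂ p₁∈) eq))
    ... | inj₂ (inj₂ (inj₁ eq))   = <⇒≱ (swapped-sum x-sw (inj₂ refl)) (small-partner {x} 1+q≤y (+p≡λₜ (proj₂ p₂∈) eq))
    ... | inj₂ (inj₂ (inj₂ eq))   = y-partner x-sw (trans (sym (m+n∸m≡n x y)) (cong (_∸ x) eq))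
      where
      y-partner : IsSwapped x → y ≢ λₜ q ∸ x
      y-partner (inj₁ refl) = y≢₁
      y-partner (inj₂ refl) = y≢₂

  unrefinable-parts : Unrefinable parts
  unrefinable-parts (a , b , a≢b , a-missing , b-missing , a+b∈)
    with missing-kind a-missing | missing-kind b-missing
  ... | inj₁ a-sw | inj₁ b-sw = two-swapped a≢b a-sw b-sw a+b∈
  ... | inj₁ a-sw | inj₂ b-hi = swapped+high a-sw b-hi a+b∈
  ... | inj₂ a-hi | inj₁ b-sw = swapped+high b-sw a-hi (subst (_∈ parts) (+-comm a b) a+b∈)
  ... | inj₂ (1+q≤a , _) | inj₂ (1+q≤b , _) = <⇒≱ λₜ<a+b (proj₂ (proj₁ (∈-parts⁻ a+b∈)))
    where
    λₜ<a+b : λₜ q < a + b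
    λₜ<a+b = begin-strict
      λₜ q           ≡⟨ λₜ≡ q ⟩
      suc q + suc q  ≡⟨ cong suc (+-suc q q) ⟩
      2 + (q + q)    <⟨ n<1+n _ ⟩
      3 + (q + q)    ≤⟨ 3+r+r≤a+b 1+q≤a 1+q≤b a≢b ⟩
      a + b          ∎
      where open ≤-Reasoning

  module _ (d : ℕ) (3≤d : 3 ≤ d) (d≤2+q : d ≤ 2 + q) (d∈parts : d ∈ parts) (gain+d≡ : swapGain + d ≡ q + 4) where

    private
      n = 3 + q
      1≤q = ≤-trans (proj₁ p₁∈) (proj₂ p₁∈)

    parts∈T : DistinctPartition (T n d) parts
    parts∈T = record
      { increasing = parts-increasing
      ; positive   = sieve-positive _ (λₜ q)
      ; sums       = +-cancelʳ-≡ d _ _ (begin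
          sum parts + d                    ≡⟨ cong (_+ d) sum-parts ⟩
          tri q + swapGain + λₜ q + d      ≡⟨ rearrange (tri q) swapGain (λₜ q) d ⟩
          tri q + λₜ q + (swapGain + d)    ≡⟨ cong (tri q + λₜ q +_) gain+d≡ ⟩
          tri q + λₜ q + (q + 4)           ≡⟨ T+d≡ q d (m≤n⇒m≤1+n d≤2+q) ⟨
          T n d + d                        ∎)
      ; twoParts   = 2≤length parts λₜ∈parts (∈-parts-large (proj₂ p₁∈) (inj₁ refl))
                              (>⇒≢ (∸-monoʳ-< (proj₁ p₁∈) (≤λₜ (proj₂ p₁∈))))
      }
      where
      open ≡-Reasoning
      rearrange : ∀ t g l d → t + g + l + d ≡ t + l + (g + d)
      rearrange t g l d = solve (t ∷ g ∷ l ∷ d ∷ [])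

    parts-setting : Setting n d parts × h n d parts ≡ suc (j n d parts)
    parts-setting = (((parts∈T , unrefinable-parts) , maximal) , largest≡2n∸4 , d∈parts) , h≡1+j
      where
      maximal : ∀ μ → InU (T n d) μ → largest μ ≤ largest parts
      maximal μ μ∈U = ≤-trans (largest-unrefinable≤ (suc q) d μ 3≤d μ∈U)
                              (≤-reflexive (sym (trans largest-parts (λₜ≡ q))))
      largest≡2n∸4 : largest parts ≡ 2 * n ∸ 4
      largest≡2n∸4 = trans largest-parts (sym (2n∸4≡λₜ q))
      h≡1+j : h n d parts ≡ suc (j n d parts)
      h≡1+j = +-cancelʳ-≡ (suc q) _ _ (begin
          h n d parts + suc q
        ≡⟨ cong (h n d parts +_) length-parts ⟨
          h n d parts + length parts
        ≡⟨ h+length≡j+length-π n d (λₜ q) parts (3+q≤λₜ 1≤q) parts-increasing parts-within ⟩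
          j n d parts + length (π n d)
        ≡⟨ cong (j n d parts +_) (suc-injective (length-π n d (≤-trans (s≤s z≤n) 3≤d , m≤n⇒m≤1+n d≤2+q))) ⟩
          j n d parts + suc (suc q)
        ≡⟨ +-suc (j n d parts) (suc q) ⟩
          suc (j n d parts) + suc q
        ∎)
        where open ≡-Reasoning

  swapGain-single : p₁ ≡ p₂ → swapGain ≡ 2 * (suc q ∸ p₁)
  swapGain-single refl = trans (∑-cong q (λ a _ → same a)) (∑-indicator (λ a → 2 * (suc q ∸ a)) q p₁ p₁∈)
    where
    same : ∀ a → (if? swapped? a then 2 * (suc q ∸ a)) ≡ (if? a ≟ p₁ then 2 * (suc q ∸ a))
    same a with a ≟ p₁
    ... | yes _ = refl
    ... | no _  = refl

  swapGain-pair : p₁ ≢ p₂ → swapGain ≡ 2 * (suc q ∸ p₁) + 2 * (suc q ∸ p₂)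
  swapGain-pair p₁≢p₂ = begin
      swapGain
    ≡⟨ ∑-cong q (λ a _ → split a) ⟩
      ∑ (λ a → (if? a ≟ p₁ then g a) + (if? a ≟ p₂ then g a)) q
    ≡⟨ ∑-+ _ _ q ⟩
      ∑ (λ a → if? a ≟ p₁ then g a) q + ∑ (λ a → if? a ≟ p₂ then g a) q
    ≡⟨ cong₂ _+_ (∑-indicator g q p₁ p₁∈) (∑-indicator g q p₂ p₂∈) ⟩
      g p₁ + g p₂
    ∎
    where
    open ≡-Reasoning
    g : ℕ → ℕ
    g a = 2 * (suc q ∸ a)
    split : ∀ a → (if? swapped? a then g a) ≡ (if? a ≟ p₁ then g a) + (if? a ≟ p₂ then g a)
    split a with a ≟ p₁ | a ≟ p₂
    ... | yes refl | yes refl = contradiction refl p₁≢p₂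
    ... | yes _    | no _     = sym (+-identityʳ _)
    ... | no _     | yes _    = refl
    ... | no _     | no _     = refl

-- Partitions in the setting of the proposition

private
  beyond : ∀ q s {N} → suc q ≤ s → s ≤ suc (suc q) → N ≡ tri (suc q) + (suc q + suc s) →
           Σ[ μ ∈ List ℕ ] (InU N μ × λₜ q < largest μ)
  beyond q s q<s s≤2+q N≡ = parts , parts∈U s≤2+q N≡ , λₜ<top
    where
    open InitialSegment (suc q) s (s≤s z≤n)
    λₜ<top : λₜ q < largest parts
    λₜ<top = subst₂ _<_ (sym (λₜ≡ q)) (sym largest-parts) (+-monoʳ-< (suc q) (s≤s q<s))

-- Witnessed by 1, …, q + 1 together with a single part above 2n − 4.
beyond-λₜ : ∀ q d → In[1, 2 ] d → Σ[ μ ∈ List ℕ ] (InU (T (3 + q) d) μ × λₜ q < largest μ)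
beyond-λₜ q 1 _ = beyond q (suc (suc q)) (n≤1+n _) ≤-refl
  (trans (T≡tri∸ (3 + q) 1) (trans (cong (_∸ 1) (rearrange (tri (suc q)))) (m+n∸m≡n 1 _)))
  where
  rearrange : ∀ t → t + suc (suc q) + suc (suc (suc q)) ≡ 1 + (t + (suc q + suc (suc (suc q))))
  rearrange t = solve (t ∷ q ∷ [])
beyond-λₜ q 2 _ = beyond q (suc q) ≤-refl (n≤1+n _)
  (trans (T≡tri∸ (3 + q) 2) (trans (cong (_∸ 2) (rearrange (tri (suc q)))) (m+n∸m≡n 2 _)))
  where
  rearrange : ∀ t → t + suc (suc q) + suc (suc (suc q)) ≡ 2 + (t + (suc q + suc (suc q)))
  rearrange t = solve (t ∷ q ∷ [])
beyond-λₜ q (suc (suc (suc _))) (_ , s≤s (s≤s ()))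

module SettingAnalysis (q d : ℕ) (λs : List ℕ) (1≤q : 1 ≤ q) (d∈ : In[1, 2 + q ] d) (setting : Setting (3 + q) d λs) where

  private
    n = 3 + q
    P = proj₁ (proj₁ (proj₁ setting))
    U = proj₂ (proj₁ (proj₁ setting))
    maximal = proj₂ (proj₁ setting)

  largest≡λₜ : largest λs ≡ λₜ q
  largest≡λₜ = trans (proj₁ (proj₂ setting)) (2n∸4≡λₜ q)

  λₜ∈ : λₜ q ∈ λs
  λₜ∈ = subst (_∈ λs) largest≡λₜ (largest∈parts P)

  λs∈ : All In[1, λₜ q ] λs
  λs∈ = subst (λ L → All In[1, L ] λs) largest≡λₜ (parts-In P)

  open PairDecomposition λs q public

  paired : Paired
  paired a (1≤a , a≤q) = subst (λ L → a ∈ λs ⊎ L ∸ a ∈ λs) largest≡λₜ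
    (unrefinable-pair U (largest∈parts P) a 1≤a (subst (a + a <_) (sym largest≡λₜ) (≤-<-trans (+-mono-≤ a≤q a≤q) (q+q<λₜ q))))

  private
    D = ∑ doubled q
    E = ∑ excess q
    G = weigh (λ _ → 1) (suc q)
    F = weigh (λ x → x) (suc q)

  excess-equation : ∑ excess q + weigh (λ x → x) (suc q) + d ≡ q + 4
  excess-equation = +-cancelˡ-≡ (tri q + λₜ q) _ _ (begin
      tri q + λₜ q + (E + F + d)       ≡⟨ rearrange (tri q) (λₜ q) E F d ⟩
      tri q + E + F + λₜ q + d         ≡⟨ cong (_+ d) (sum≡tri+∑excess (increasing P) λs∈ λₜ∈ paired) ⟨
      sum λs + d                       ≡⟨ cong (_+ d) (sums P) ⟩
      T n d + d                        ≡⟨ T+d≡ q d (m≤n⇒m≤1+n (proj₂ d∈)) ⟩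
      tri q + λₜ q + (q + 4)           ∎)
    where
    open ≡-Reasoning
    rearrange : ∀ t l e f d → t + l + (e + f + d) ≡ t + e + f + l + d
    rearrange t l e f d = solve (t ∷ l ∷ e ∷ f ∷ d ∷ [])

  count-equation : h n d λs + (∑ doubled q + weigh (λ _ → 1) (suc q)) ≡ j n d λs + 1
  count-equation = +-cancelʳ-≡ (suc q) _ _ (begin
      h n d λs + (D + G) + suc q
    ≡⟨ rearrange (h n d λs) q D G ⟩
      h n d λs + (q + D + G + 1)
    ≡⟨ cong (h n d λs +_) (length≡q+∑doubled (increasing P) λs∈ λₜ∈ paired) ⟨
      h n d λs + length λs
    ≡⟨ h+length≡j+length-π n d (λₜ q) λs (3+q≤λₜ 1≤q) (increasing P) λs∈ ⟩
      j n d λs + length (π n d)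
    ≡⟨ cong (j n d λs +_) (suc-injective (length-π n d (proj₁ d∈ , m≤n⇒m≤1+n (proj₂ d∈)))) ⟩
      j n d λs + suc (suc q)
    ≡⟨ +-assoc (j n d λs) 1 (suc q) ⟨
      j n d λs + 1 + suc q
    ∎)
    where
    open ≡-Reasoning
    rearrange : ∀ h q D G → h + (D + G) + suc q ≡ h + (q + D + G + 1)
    rearrange h q D G = solve (h ∷ q ∷ D ∷ G ∷ [])

  3≤d : 3 ≤ d
  3≤d with d ≤? 2
  ... | no d≰2 = ≰⇒> d≰2
  ... | yes d≤2 with μ , μ∈U , λₜ<μ ← beyond-λₜ q d (proj₁ d∈ , d≤2) =
    contradiction (≤-trans (maximal μ μ∈U) (≤-reflexive largest≡λₜ)) (<⇒≱ λₜ<μ)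

  h≡j⇒ : h n d λs ≡ j n d λs → d ≡ 3 × suc q ∈ λs × ∑ excess q ≡ 0
  h≡j⇒ h≡j with suc q ∈? λs
  ... | yes m∈ = d≡3 , m∈ , E≡0
    where
    E+d≡3 : E + d ≡ 3
    E+d≡3 = +-cancelʳ-≡ (suc q) _ _ (begin
      E + d + suc q    ≡⟨ +-comm-middle E d (suc q) ⟩
      E + suc q + d    ≡⟨ cong (λ f → E + f + d) (if?-yes (suc q ∈? λs) m∈) ⟨
      E + F + d        ≡⟨ excess-equation ⟩
      q + 4            ≡⟨ solve (q ∷ []) ⟩
      3 + suc q        ∎)
      where
      open ≡-Reasoning
      +-comm-middle : ∀ a b c → a + b + c ≡ a + c + b
      +-comm-middle a b c = solve (a ∷ b ∷ c ∷ [])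
    E≡0 : E ≡ 0
    E≡0 = n≤0⇒n≡0 (+-cancelʳ-≤ 3 E 0 (≤-trans (+-monoʳ-≤ E 3≤d) (≤-reflexive E+d≡3)))
    d≡3 : d ≡ 3
    d≡3 = trans (cong (_+ d) (sym E≡0)) E+d≡3
  ... | no m∉ = contradiction excess-equation (>⇒≢ (begin-strict
      q + 4             <⟨ ≤-reflexive (solve (q ∷ [])) ⟩
      suc (suc q) + 3   ≤⟨ +-mono-≤ (∑doubled>0⇒∑excess≥ paired D>0) 3≤d ⟩
      E + d             ≡⟨ cong (_+ d) (+-identityʳ E) ⟨
      E + 0 + d         ≡⟨ cong (λ f → E + f + d) (if?-no (suc q ∈? λs) m∉) ⟨
      E + F + d         ∎))
    where
    open ≤-Reasoning
    D+0≡1 : D + 0 ≡ 1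
    D+0≡1 = trans (cong (D +_) (sym (if?-no (suc q ∈? λs) m∉)))
                  (+-cancelˡ-≡ (j n d λs) _ _ (trans (cong (_+ (D + G)) (sym h≡j)) count-equation))
    D>0 : 0 < D
    D>0 = subst (0 <_) (sym (trans (sym (+-identityʳ D)) D+0≡1)) (s≤s z≤n)

  private
    h≡1+j⇒D+G≡0 : h n d λs ≡ suc (j n d λs) → D + G ≡ 0
    h≡1+j⇒D+G≡0 h≡1+j = +-cancelˡ-≡ (suc (j n d λs)) _ _
      (trans (cong (_+ (D + G)) (sym h≡1+j)) (trans count-equation (trans (+-comm _ 1) (sym (+-identityʳ _)))))

  h≢1+j : ∀ k → d + 2 * k ≡ n → h n d λs ≢ suc (j n d λs)
  h≢1+j k d+2k≡n h≡1+j with suc q ∈? λs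
  ... | yes m∈ = contradiction (m+n≡0⇒n≡0 D (h≡1+j⇒D+G≡0 h≡1+j)) (subst (_≢ 0) (sym (if?-yes (suc q ∈? λs) m∈)) λ ())
  ... | no m∉ = contradiction (∣m+n∣m⇒∣n 2∣2k+1 (m∣m*n k)) λ 2∣1 → contradiction (∣1⇒≡1 2∣1) λ ()
    where
    E≡2k+1 : E ≡ 2 * k + 1
    E≡2k+1 = +-cancelʳ-≡ d _ _ (begin
      E + d          ≡⟨ cong (_+ d) (+-identityʳ E) ⟨
      E + 0 + d      ≡⟨ cong (λ f → E + f + d) (if?-no (suc q ∈? λs) m∉) ⟨
      E + F + d      ≡⟨ excess-equation ⟩
      q + 4          ≡⟨ solve (q ∷ []) ⟩
      3 + q + 1      ≡⟨ cong (_+ 1) d+2k≡n ⟨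
      d + 2 * k + 1  ≡⟨ solve (d ∷ k ∷ []) ⟩
      2 * k + 1 + d  ∎)
      where open ≡-Reasoning
    2∣2k+1 : 2 ∣ 2 * k + 1
    2∣2k+1 = subst (2 ∣_) E≡2k+1 (∑doubled≡0⇒2∣∑excess paired (m+n≡0⇒m≡0 D (h≡1+j⇒D+G≡0 h≡1+j)))

  h≡j⇒canonical : h n d λs ≡ j n d λs → λs ≡ InitialSegment.parts (suc q) q (s≤s z≤n)
  h≡j⇒canonical h≡j = Increasing-≡ (increasing P) parts-increasing λs⊆ ⊆λs
    where
    open InitialSegment (suc q) q (s≤s z≤n)
    m∈ = proj₁ (proj₂ (h≡j⇒ h≡j))
    onlyLower : ∀ a → In[1, q ] a → a ∈ λs × λₜ q ∸ a ∉ λs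
    onlyLower = ∑excess≡0⇒lower paired (proj₂ (proj₂ (h≡j⇒ h≡j)))
    top≡λₜ : top ≡ λₜ q
    top≡λₜ = sym (λₜ≡ q)
    λs⊆ : ∀ {x} → x ∈ λs → x ∈ parts
    λs⊆ {x} x∈ with All.lookup λs∈ x∈
    ... | 1≤x , x≤λₜ with x ≤? suc q | x ≟ λₜ q
    ...   | yes x≤m | _        = ∈-parts⁺ (1≤x , subst (x ≤_) (sym top≡λₜ) x≤λₜ) (inj₁ x≤m)
    ...   | no _    | yes refl = ∈-parts⁺ (1≤x , subst (x ≤_) (sym top≡λₜ) x≤λₜ) (inj₂ (sym top≡λₜ))
    ...   | no x≰m  | no x≢λₜ  = contradiction (subst (_∈ λs) (sym (m∸[m∸n]≡n x≤λₜ)) x∈) (proj₂ (onlyLower a a∈))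
      where
      a = λₜ q ∸ x
      a∈ : In[1, q ] a
      a∈ = m<n⇒0<n∸m (≤∧≢⇒< x≤λₜ x≢λₜ)
         , ≤-trans (∸-monoʳ-≤ (λₜ q) (≰⇒> x≰m)) (≤-reflexive (m+n∸n≡m q (2 + q)))
    ⊆λs : ∀ {x} → x ∈ parts → x ∈ λs
    ⊆λs x∈ with ∈-parts⁻ x∈
    ... | _ , inj₂ refl = subst (_∈ λs) (sym top≡λₜ) λₜ∈
    ... | (1≤x , _) , inj₁ x≤m with m≤n⇒m<n∨m≡n x≤m
    ...   | inj₁ (s≤s x≤q) = proj₁ (onlyLower _ (1≤x , x≤q))
    ...   | inj₂ refl      = m∈

canonical : ℕ → List ℕ
canonical q = InitialSegment.parts (suc q) q (s≤s z≤n)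

canonical-setting : ∀ q → 2 ≤ q → Setting (3 + q) 3 (canonical q) × h (3 + q) 3 (canonical q) ≡ j (3 + q) 3 (canonical q)
canonical-setting q 2≤q = ((parts∈U (≤-trans (n≤1+n q) (n≤1+n _)) T≡ , maximal) , largest≡2n∸4 , 3∈) , h≡j
  where
  open InitialSegment (suc q) q (s≤s z≤n)
  n = 3 + q
  T≡ : T n 3 ≡ tri (suc q) + top
  T≡ = trans (T≡tri∸ n 3) (trans (cong (_∸ 3) (rearrange (tri (suc q)))) (m+n∸m≡n 3 _))
    where
    rearrange : ∀ t → t + suc (suc q) + suc (suc (suc q)) ≡ 3 + (t + (suc q + suc q))
    rearrange t = solve (t ∷ q ∷ [])
  maximal : ∀ μ → InU (T n 3) μ → largest μ ≤ largest parts
  maximal μ μ∈U = ≤-trans (largest-unrefinable≤ (suc q) 3 μ ≤-refl μ∈U) (≤-reflexive (sym largest-parts))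
  largest≡2n∸4 : largest parts ≡ 2 * n ∸ 4
  largest≡2n∸4 = trans largest-parts (sym (trans (2n∸4≡λₜ q) (λₜ≡ q)))
  3∈ : 3 ∈ parts
  3∈ = ∈-parts⁺ (s≤s z≤n , ≤-trans (s≤s 2≤q) (m≤m+n (suc q) _)) (inj₁ (s≤s 2≤q))
  h≡j : h n 3 parts ≡ j n 3 parts
  h≡j = +-cancelʳ-≡ (suc q + 1) _ _ (begin
    h n 3 parts + (suc q + 1)     ≡⟨ cong (h n 3 parts +_) length-parts ⟨
    h n 3 parts + length parts    ≡⟨ h+length≡j+length-π n 3 top parts n≤top parts-increasing parts-within ⟩
    j n 3 parts + length (π n 3)  ≡⟨ cong (j n 3 parts +_) (suc-injective (length-π n 3 (s≤s z≤n , s≤s (s≤s (s≤s z≤n))))) ⟩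
    j n 3 parts + suc (suc q)     ≡⟨ cong (j n 3 parts +_) (+-comm 1 (suc q)) ⟩
    j n 3 parts + (suc q + 1)     ∎)
    where
    open ≡-Reasoning
    n≤top : n ≤ top
    n≤top = subst (_≤ top) (+-comm (suc q) 2) (+-monoʳ-≤ (suc q) (s≤s (≤-trans (s≤s z≤n) 2≤q)))

Realised : ℕ → ℕ → Set
Realised q d = ∃[ λs ] (Setting (3 + q) d λs × h (3 + q) d λs ≡ suc (j (3 + q) d λs))

swap-realises : ∀ {q p₁ p₂} (S : Swappable q p₁ p₂) d → 3 ≤ d → d ≤ 2 + q →
                d ∈ Swapped.parts S → Swapped.swapGain S + d ≡ q + 4 → Realised q d
swap-realises S d 3≤d d≤2+q d∈ gain+d≡ = parts , parts-setting d 3≤d d≤2+q d∈ gain+d≡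
  where open Swapped S

realised-2+q : ∀ q → 3 ≤ q → Realised q (2 + q)
realised-2+q q 3≤q = swap-realises S (2 + q) (≤-trans 3≤q (m≤n+m q 2)) ≤-refl 2+q∈ gain
  where
  q∈ : In[1, q ] q
  q∈ = ≤-trans (s≤s (z≤n {2})) 3≤q , ≤-refl
  1+q<q+q : suc q < q + q
  1+q<q+q = +-monoˡ-≤ q (≤-trans (s≤s (s≤s (z≤n {1}))) 3≤q)
  λₜ<3q : λₜ q < q + q + q
  λₜ<3q = begin-strict
    q + (2 + q)   <⟨ +-monoʳ-< q (+-monoˡ-≤ q 3≤q) ⟩
    q + (q + q)   ≡⟨ +-assoc q q q ⟨
    q + q + q     ∎
    where open ≤-Reasoning
  S : Swappable q q q
  S = record { p₁∈ = q∈ ; p₂∈ = q∈ ; 1+q<p₁+p₁ = 1+q<q+q ; 1+q<p₂+p₂ = 1+q<q+q ; 1+q<p₁+p₂ = 1+q<q+q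
             ; p₁+p₂+p₁≢λₜ = >⇒≢ λₜ<3q ; p₁+p₂+p₂≢λₜ = >⇒≢ λₜ<3q }
  open Swapped S
  2+q∈ : 2 + q ∈ parts
  2+q∈ = subst (_∈ parts) (m+n∸m≡n q (2 + q)) (∈-parts-large ≤-refl (inj₁ refl))
  gain : swapGain + (2 + q) ≡ q + 4
  gain = trans (cong (λ g → g + (2 + q)) (trans (swapGain-single refl) (cong (2 *_) (m+n∸n≡m 1 q))))
               (+-comm 4 q)

realised-q : ∀ p → 5 ≤ p → Realised (suc p) (suc p)
realised-q p 5≤p = swap-realises S (suc p) 3≤1+p (m≤n⇒m≤1+n (n≤1+n _)) 1+p∈ gain
  where
  q = suc p
  3≤1+p : 3 ≤ suc p
  3≤1+p = m≤n⇒m≤1+n (≤-trans (s≤s (s≤s (s≤s (z≤n {2})))) 5≤p)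
  p∈ : In[1, q ] p
  p∈ = ≤-trans (s≤s (z≤n {4})) 5≤p , n≤1+n p
  1+q<p+p : suc q < p + p
  1+q<p+p = +-monoˡ-≤ p (≤-trans (s≤s (s≤s (s≤s (z≤n {2})))) 5≤p)
  λₜ<3p : λₜ q < p + p + p
  λₜ<3p = begin-strict
    suc p + (2 + suc p) ≡⟨ solve (p ∷ []) ⟩
    4 + (p + p)    <⟨ +-monoˡ-≤ (p + p) 5≤p ⟩
    p + (p + p)    ≡⟨ +-assoc p p p ⟨
    p + p + p      ∎
    where open ≤-Reasoning
  S : Swappable q p p
  S = record { p₁∈ = p∈ ; p₂∈ = p∈ ; 1+q<p₁+p₁ = 1+q<p+p ; 1+q<p₂+p₂ = 1+q<p+p ; 1+q<p₁+p₂ = 1+q<p+p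
             ; p₁+p₂+p₁≢λₜ = >⇒≢ λₜ<3p ; p₁+p₂+p₂≢λₜ = >⇒≢ λₜ<3p }
  open Swapped S
  1+p∈ : suc p ∈ parts
  1+p∈ = ∈-parts-small (s≤s z≤n , ≤-refl) λ { (inj₁ 1+p≡p) → 1+n≢n 1+p≡p ; (inj₂ 1+p≡p) → 1+n≢n 1+p≡p }
  gain : swapGain + suc p ≡ q + 4
  gain = trans (cong (_+ suc p) (trans (swapGain-single refl) (cong (2 *_) (m+n∸n≡m 2 p)))) (+-comm 4 (suc p))

private
  <-by : ∀ a c {b} → a + suc c ≡ b → a < b
  <-by a c refl = m<m+n a (s≤s z≤n)

-- With q = 5 + 2u + t, swapping p₁ = q and p₂ = q − (u + 1) gains 2 + 2(u + 2) = 2k for k = u + 3.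
realised-3+t : ∀ u t → Realised (5 + (u + u) + t) (3 + t)
realised-3+t u t = swap-realises S (3 + t) (m≤m+n 3 t) (<⇒≤ (<-by (3 + t) (3 + (u + u)) (d-gap u t))) d∈ gain
  where
  Q = 5 + (u + u) + t
  P = 4 + u + t
  d-gap : ∀ u t → 3 + t + suc (3 + (u + u)) ≡ 2 + (5 + (u + u) + t)
  d-gap = solve-∀
  P-gap : ∀ u t → 4 + u + t + suc u ≡ 5 + (u + u) + t
  P-gap = solve-∀
  QQ-gap : ∀ u t → suc (5 + (u + u) + t) + suc (3 + (u + u) + t) ≡ (5 + (u + u) + t) + (5 + (u + u) + t)
  QQ-gap = solve-∀
  PP-gap : ∀ u t → suc (5 + (u + u) + t) + suc (1 + t) ≡ (4 + u + t) + (4 + u + t)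
  PP-gap = solve-∀
  QP-gap : ∀ u t → suc (5 + (u + u) + t) + suc (2 + u + t) ≡ (5 + (u + u) + t) + (4 + u + t)
  QP-gap = solve-∀
  QPQ-gap : ∀ u t → (5 + (u + u) + t) + (1 + suc (5 + (u + u) + t)) + suc (1 + u + t) ≡ (5 + (u + u) + t) + (4 + u + t) + (5 + (u + u) + t)
  QPQ-gap = solve-∀
  QPP-gap : ∀ u t → (5 + (u + u) + t) + (1 + suc (5 + (u + u) + t)) + suc t ≡ (5 + (u + u) + t) + (4 + u + t) + (4 + u + t)
  QPP-gap = solve-∀
  dQ-gap : ∀ u t → 3 + t + suc (1 + (u + u)) ≡ 5 + (u + u) + t
  dQ-gap = solve-∀
  dP-gap : ∀ u t → 3 + t + suc u ≡ 4 + u + t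
  dP-gap = solve-∀
  S : Swappable Q Q P
  S = record
    { p₁∈ = s≤s z≤n , ≤-refl
    ; p₂∈ = s≤s z≤n , <⇒≤ (<-by P u (P-gap u t))
    ; 1+q<p₁+p₁ = <-by (suc Q) _ (QQ-gap u t)
    ; 1+q<p₂+p₂ = <-by (suc Q) _ (PP-gap u t)
    ; 1+q<p₁+p₂ = <-by (suc Q) _ (QP-gap u t)
    ; p₁+p₂+p₁≢λₜ = >⇒≢ (<-by (λₜ Q) _ (QPQ-gap u t))
    ; p₁+p₂+p₂≢λₜ = >⇒≢ (<-by (λₜ Q) _ (QPP-gap u t))
    }
  open Swapped S
  d∈ : 3 + t ∈ parts
  d∈ = ∈-parts-small (s≤s z≤n , <⇒≤ (<-by (3 + t) _ (dQ-gap u t)))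
         λ { (inj₁ d≡Q) → <⇒≢ (<-by (3 + t) _ (dQ-gap u t)) d≡Q
           ; (inj₂ d≡P) → <⇒≢ (<-by (3 + t) _ (dP-gap u t)) d≡P }
  gain : swapGain + (3 + t) ≡ Q + 4
  gain = begin
      swapGain + (3 + t)
    ≡⟨ cong (_+ (3 + t)) (swapGain-pair (>⇒≢ (<-by P u (P-gap u t)))) ⟩
      2 * (suc Q ∸ Q) + 2 * (suc Q ∸ P) + (3 + t)
    ≡⟨ cong₂ (λ a b → 2 * a + 2 * b + (3 + t)) (m+n∸n≡m 1 Q) (cong (_∸ P) (split u t)) ⟩
      2 * 1 + 2 * ((2 + u) + P ∸ P) + (3 + t)
    ≡⟨ cong (λ b → 2 * 1 + 2 * b + (3 + t)) (m+n∸n≡m (2 + u) P) ⟩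
      2 * 1 + 2 * (2 + u) + (3 + t)
    ≡⟨ total u t ⟩
      Q + 4
    ∎
    where
    open ≡-Reasoning
    split : ∀ u t → suc (5 + (u + u) + t) ≡ (2 + u) + (4 + u + t)
    split = solve-∀
    total : ∀ u t → 2 * 1 + 2 * (2 + u) + (3 + t) ≡ 5 + (u + u) + t + 4
    total = solve-∀

private
  d≡3+t : ∀ u t → 3 + (5 + (u + u) + t) ∸ (2 * (3 + u) ∸ 1) ≡ 3 + t
  d≡3+t u t = trans (cong₂ _∸_ (n≡ u t) (trans (cong (_∸ 1) (2k≡ u)) (m+n∸m≡n 1 _))) (m+n∸m≡n (5 + (u + u)) (3 + t))
    where
    n≡ : ∀ u t → 3 + (5 + (u + u) + t) ≡ 5 + (u + u) + (3 + t)
    n≡ = solve-∀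
    2k≡ : ∀ u → 2 * (3 + u) ≡ 1 + (5 + (u + u))
    2k≡ = solve-∀

  1+q≡2k+t : ∀ u t → suc (5 + (u + u) + t) ≡ 2 * (3 + u) + t
  1+q≡2k+t = solve-∀

realised-odd : ∀ q → 8 ≤ q → ∀ k → 1 ≤ k → 2 * k ≤ suc q → Realised q (3 + q ∸ (2 * k ∸ 1))
realised-odd q 8≤q 1 _ _ = realised-2+q q (≤-trans (s≤s (s≤s (s≤s (z≤n {5})))) 8≤q)
realised-odd (suc p) (s≤s 7≤p) 2 _ _ = realised-q p (≤-trans (s≤s (s≤s (s≤s (s≤s (s≤s (z≤n {2})))))) 7≤p)
realised-odd q _ (suc (suc (suc u))) _ 2k≤1+q with t , 2k+t≡1+q ← m≤n⇒∃[o]m+o≡n 2k≤1+q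
  with refl ← suc-injective (trans (1+q≡2k+t u t) 2k+t≡1+q) = subst (Realised _) (sym (d≡3+t u t)) (realised-3+t u t)

2k≤1+q : ∀ q k → k ≤ suc q / 2 → 2 * k ≤ suc q
2k≤1+q q k k≤ = ≤-trans (≤-reflexive (*-comm 2 k)) (≤-trans (*-monoˡ-≤ 2 k≤) (m/n*n≤m (suc q) 2))

proposition2p11 : ∀ (n : ℕ) → 11 ≤ n →
    -- (i)
    ((∀ (d : ℕ) → 1 ≤ d → d ≤ n ∸ 1 → ∀ (λs : List ℕ) →
        Setting n d λs → h n d λs ≡ j n d λs → d ≡ 3)
     × (∃[ λs ] ((Setting n 3 λs × h n 3 λs ≡ j n 3 λs)
          × (∀ (μ : List ℕ) → Setting n 3 μ → h n 3 μ ≡ j n 3 μ → μ ≡ λs))))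
    -- (ii)
    × (∀ (k : ℕ) → 1 ≤ k → k ≤ (n ∸ 2) / 2 →
        (∃[ λs ] (Setting n (n ∸ (2 * k ∸ 1)) λs
            × h n (n ∸ (2 * k ∸ 1)) λs ≡ suc (j n (n ∸ (2 * k ∸ 1)) λs)))
        × (∀ (λs : List ℕ) → ¬ (Setting n (n ∸ 2 * k) λs
            × h n (n ∸ 2 * k) λs ≡ suc (j n (n ∸ 2 * k) λs))))
proposition2p11 (suc (suc (suc q))) (s≤s (s≤s (s≤s 8≤q))) =
  (d≡3 , canonical q , canonical-setting q 2≤q , unique) ,
  λ k 1≤k k≤ → realised-odd q 8≤q k 1≤k (2k≤1+q q k k≤) , even-gap-impossible k 1≤k (2k≤1+q q k k≤)
  where
  2≤q = ≤-trans (s≤s (s≤s (z≤n {6}))) 8≤q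
  1≤q = ≤-trans (s≤s z≤n) 2≤q
  open SettingAnalysis
  d≡3 : ∀ d → 1 ≤ d → d ≤ 2 + q → ∀ λs → Setting (3 + q) d λs → h (3 + q) d λs ≡ j (3 + q) d λs → d ≡ 3
  d≡3 d 1≤d d≤2+q λs setting h≡j = proj₁ (h≡j⇒ q d λs 1≤q (1≤d , d≤2+q) setting h≡j)
  unique : ∀ μ → Setting (3 + q) 3 μ → h (3 + q) 3 μ ≡ j (3 + q) 3 μ → μ ≡ canonical q
  unique μ setting = h≡j⇒canonical q 3 μ 1≤q (s≤s z≤n , s≤s (s≤s 1≤q)) setting
  even-gap-impossible : ∀ k → 1 ≤ k → 2 * k ≤ suc q → ∀ λs →
    ¬ (Setting (3 + q) (3 + q ∸ 2 * k) λs × h (3 + q) (3 + q ∸ 2 * k) λs ≡ suc (j (3 + q) (3 + q ∸ 2 * k) λs))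
  even-gap-impossible k 1≤k 2k≤1+q λs (setting , h≡1+j) =
    h≢1+j q (3 + q ∸ 2 * k) λs 1≤q d∈ setting k (m∸n+n≡m (m≤n⇒m≤1+n (m≤n⇒m≤1+n 2k≤1+q))) h≡1+j
    where
    d∈ : In[1, 2 + q ] (3 + q ∸ 2 * k)
    d∈ = m<n⇒0<n∸m (s≤s (m≤n⇒m≤1+n 2k≤1+q)) , ≤-trans (∸-monoʳ-≤ (3 + q) (*-monoʳ-≤ 2 1≤k)) (n≤1+n _)
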